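{- Let $k \geq 2$ be an integer and let $G$ be a $k$-connected graph with $n \geq 3$ vertices and $e$ edges, minimum degree $\delta$ and maximum degree $\Delta$. If $$M_1(G) \geq (n - k - 1)\Delta^2 + \frac{\bigl(e (\delta + n - k - 1)\bigr)^2}{4 \delta (n - k - 1)(k + 1)},$$ then $G$ is Hamiltonian or $G$ is the complete bipartite graph $K_{k,\, k+1}$.
   Context: All graphs are finite, undirected, without loops or multiple edges. For a graph $G$, $d_G(u)$ denotes the degree of a vertex $u$, $\delta$ and $\Delta$ denote the minimum and maximum degree of $G$, and the first Zagreb index is $M_1(G) = \sum_{u \in V(G)} d_G^2(u)$. A graph is Hamiltonian if it has a cycle containing all its vertices. $K_{a,b}$ denotes the complete bipartite graph with parts of sizes $a$ and $b$. -}

module Defs where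

open import Data.Nat using (ℕ; zero; suc; _+_; _*_; _∸_; _^_; _≤_; _<_)
open import Data.Bool using (Bool; true; false; if_then_else_; _xor_; not)
open import Data.Fin using (Fin; toℕ)
open import Data.List using (List; map; allFin)
open import Data.Nat.ListAction using (sum)
open import Data.Product using (Σ; ∃; _×_; _,_)
open import Relation.Binary.PropositionalEquality using (_≡_)
open import Function.Definitions using (Injective)

record Graph (n : ℕ) : Set where
  field
    adj   : Fin n → Fin n → Bool
    sym   : ∀ u v → adj u v ≡ adj v u
    irrefl : ∀ u → adj u u ≡ false
open Graph public

count : {n : ℕ} → (Fin n → Bool) → ℕ
count {n} p = sum (map (λ v → if p v then 1 else 0) (allFin n))

degree : {n : ℕ} → Graph n → Fin n → ℕ
degree G u = count (adj G u)

edgeCount : {n : ℕ} → Graph n → ℕ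
edgeCount {n} G =
  sum (map (λ u → sum (map (λ v → if adj G u v then (if toℕ u Data.Nat.<ᵇ toℕ v then 1 else 0) else 0)
                          (allFin n)))
           (allFin n))

M₁ : {n : ℕ} → Graph n → ℕ
M₁ {n} G = sum (map (λ u → degree G u ^ 2) (allFin n))

IsMinDegree : {n : ℕ} → Graph n → ℕ → Set
IsMinDegree G δ = (∀ u → δ ≤ degree G u) × ∃ (λ u → degree G u ≡ δ)

IsMaxDegree : {n : ℕ} → Graph n → ℕ → Set
IsMaxDegree G Δ = (∀ u → degree G u ≤ Δ) × ∃ (λ u → degree G u ≡ Δ)

data Walk {n : ℕ} (G : Graph n) (S : Fin n → Bool) : Fin n → Fin n → Set where
  here : ∀ {u} → Walk G S u u
  step : ∀ {u w v} → adj G u w ≡ true → S w ≡ false → Walk G S w v → Walk G S u v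

ConnectedWithout : {n : ℕ} → Graph n → (Fin n → Bool) → Set
ConnectedWithout G S = ∀ u v → S u ≡ false → S v ≡ false → Walk G S u v

KConnected : {n : ℕ} → ℕ → Graph n → Set
KConnected {n} k G = k < n × (∀ (S : Fin n → Bool) → count S < k → ConnectedWithout G S)

-- Hamiltonian: a cyclic ordering σ of all vertices (σ injective, hence a
-- bijection of Fin n) with consecutive vertices adjacent, including last–first
Hamiltonian : {n : ℕ} → Graph n → Set
Hamiltonian {n} G = Σ (Fin n → Fin n) λ σ →
    Injective _≡_ _≡_ σ
  × (∀ i j → suc (toℕ i) ≡ toℕ j → adj G (σ i) (σ j) ≡ true)
  × (∀ i j → suc (toℕ i) ≡ n → toℕ j ≡ 0 → adj G (σ i) (σ j) ≡ true)

-- G is (isomorphic to) the complete bipartite graph K_{a,b}: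
-- n = a + b, and a bipartition with a vertices on the 'true' side such that
-- u,v adjacent iff they lie on different sides
IsCompleteBipartite : {n : ℕ} → Graph n → ℕ → ℕ → Set
IsCompleteBipartite {n} G a b = n ≡ a + b × Σ (Fin n → Bool) λ side →
  count side ≡ a × (∀ u v → adj G u v ≡ (side u xor side v))

-- By the cycle-extension argument of Chvátal and Erdős, a k-connected graph is Hamiltonian or
-- has an independent set I with |I| ≥ k + 1: take a cycle C missing a vertex h, let H be the
-- component of h in G − C and A the vertices of C with a neighbour in H. Unless C can be
-- lengthened through H, the successors on C of the vertices of A, together with h, are
-- independent, and |A| ≥ k because A separates H from the rest of C.
--
-- Given such an I, with m = n − k − 1 ≥ |V∖I| every vertex of I has degree between δ and m, so
-- Σ_I d² + y ≤ x ≤ E for y = δ m (k + 1), x = (δ + m) Σ_I d and E = (δ + m) e, while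
-- Σ_{V∖I} d² ≤ m Δ². The hypothesis then gives E² ≤ 4y (x − y) ≤ x² ≤ E², so all these
-- inequalities are equalities: |I| = k + 1, every edge has exactly one end in I, every vertex
-- outside I has degree Δ, and finally m = δ, so G is the complete bipartite graph between I and
-- V∖I. It is K_{k,k+1} if m = k and a Hamiltonian K_{k+1,k+1} if m = k + 1.

module Submission where

open import Data.Bool using (Bool; true; false; not; _xor_; if_then_else_)
open import Data.Bool.Properties using (T-≡; ¬-not; not-injective) renaming (_≟_ to _≟ᵇ_)
open import Data.Empty using (⊥; ⊥-elim)
open import Data.Fin using (Fin; toℕ)
import Data.Fin as Fin
open import Data.Fin.Properties using (any?; toℕ-injective; toℕ<n) renaming (_≟_ to _≟ᶠ_)
open import Data.List using (List; []; _∷_; _++_; length; map; reverse; allFin; filterᵇ)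
import Data.List.Membership.DecPropositional as DecMembership
open import Data.List.Membership.Propositional using (_∈_; _∉_; find; lose)
open import Data.List.Membership.Propositional.Properties
  using (∈-allFin; ∈-filter⁺; ∈-filter⁻; ∈-++⁺ˡ; ∈-++⁺ʳ; ∈-++⁻; ∈-map⁺; ∈-map⁻)
open import Data.List.Properties using (length-++; length-map; length-reverse; length-tabulate; map-cong; unfold-reverse)
open import Data.List.Relation.Binary.Disjoint.Propositional using (Disjoint)
open import Data.List.Relation.Binary.Permutation.Propositional using (_↭_; ↭-refl; ↭-sym)
open import Data.List.Relation.Binary.Permutation.Propositional.Properties using (++-comm; ∈-resp-↭; ↭-length)
open import Data.List.Relation.Binary.Subset.Propositional using (_⊆_)
open import Data.List.Relation.Unary.All using (All; []; _∷_)
import Data.List.Relation.Unary.All as All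
open import Data.List.Relation.Unary.All.Properties using (¬Any⇒All¬; ++⁻ˡ; ++⁻ʳ)
open import Data.List.Relation.Unary.AllPairs using ([]; _∷_)
import Data.List.Relation.Unary.AllPairs.Properties as AllPairs
open import Data.List.Relation.Unary.Any using (here; there; _─_)
import Data.List.Relation.Unary.Any as Any
open import Data.List.Relation.Unary.Any.Properties using (reverse⁻)
open import Data.List.Relation.Unary.Unique.Propositional using (Unique)
open import Data.List.Relation.Unary.Unique.Propositional.Properties
  using (++⁺; allFin⁺; filter⁺; Unique[x∷xs]⇒x∉xs)
open import Data.Nat using (ℕ; zero; suc; _+_; _*_; _∸_; _^_; _≤_; _<_; _≥_; _≤?_; _<ᵇ_; z≤n; s≤s; >-nonZero)
open import Data.Nat.ListAction using (sum)
open import Data.Nat.Properties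
open import Data.Nat.Tactic.RingSolver using (solve-∀)
open import Algebra.Properties.CommutativeSemigroup +-commutativeSemigroup using () renaming (interchange to +-interchange)
open import Data.Product using (Σ; ∃; _×_; _,_; proj₁; proj₂)
open import Data.Sum using (_⊎_; inj₁; inj₂; [_,_]′)
import Data.Sum
open import Function using (_∘_; Equivalence)
open import Relation.Binary.PropositionalEquality
  using (_≡_; _≢_; refl; sym; trans; cong; cong₂; subst; subst₂; module ≡-Reasoning)
open import Relation.Nullary using (Dec; yes; no; does; ¬_)
open import Relation.Nullary.Decidable using (dec-true; dec-false; decidable-stable; _×-dec_; _⊎-dec_; ¬?)
open import Relation.Nullary.Decidable.Core using (T?)

open import Defs hiding (sym)

dec-true⁻¹ : ∀ {a} {P : Set a} (P? : Dec P) → does P? ≡ true → P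
dec-true⁻¹ (yes p) _ = p

module _ {A : Set} where

  Unique-∷ : ∀ {x : A} {xs} → x ∉ xs → Unique xs → Unique (x ∷ xs)
  Unique-∷ {xs = xs} x∉xs u = ¬Any⇒All¬ xs x∉xs ∷ u

  Unique-++⁻ : ∀ xs {ys : List A} → Unique (xs ++ ys) → Unique xs × Unique ys × Disjoint xs ys
  Unique-++⁻ [] u = [] , u , λ ()
  Unique-++⁻ (x ∷ xs) (x∉ ∷ u) with Unique-++⁻ xs u
  ... | uxs , uys , disj = ++⁻ˡ xs x∉ ∷ uxs , uys , λ where
    (here refl , v∈ys) → All.lookup (++⁻ʳ xs x∉) v∈ys refl
    (there v∈xs , v∈ys) → disj (v∈xs , v∈ys)

  Unique-++-comm : ∀ xs {ys : List A} → Unique (xs ++ ys) → Unique (ys ++ xs)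
  Unique-++-comm xs u with Unique-++⁻ xs u
  ... | uxs , uys , disj = ++⁺ uys uxs λ (v∈ys , v∈xs) → disj (v∈xs , v∈ys)

  Unique-reverse : ∀ {xs : List A} → Unique xs → Unique (reverse xs)
  Unique-reverse {[]} u = u
  Unique-reverse {x ∷ xs} u@(_ ∷ uxs) rewrite unfold-reverse x xs =
    ++⁺ (Unique-reverse uxs) ([] ∷ []) λ where
      (v∈rev , here refl) → Unique[x∷xs]⇒x∉xs u (reverse⁻ v∈rev)

  Unique-splice : ∀ {xs ys ps : List A} → Unique (xs ++ ys) → Unique ps → Disjoint ps (xs ++ ys) →
                  Unique (ys ++ ps ++ reverse xs)
  Unique-splice {xs} {ys} {ps} u ups ps∩xsys with Unique-++⁻ xs u
  ... | uxs , uys , xs∩ys = ++⁺ uys (++⁺ ups (Unique-reverse uxs) ps∩rev) ys∩rest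
    where
    ps∩rev : Disjoint ps (reverse xs)
    ps∩rev (v∈ps , v∈rev) = ps∩xsys (v∈ps , ∈-++⁺ˡ (reverse⁻ {xs = xs} v∈rev))
    ys∩rest : Disjoint ys (ps ++ reverse xs)
    ys∩rest (v∈ys , v∈rest) with ∈-++⁻ ps v∈rest
    ... | inj₁ v∈ps = ps∩xsys (v∈ps , ∈-++⁺ʳ xs v∈ys)
    ... | inj₂ v∈rev = xs∩ys (reverse⁻ {xs = xs} v∈rev , v∈ys)

  Unique-map-filterᵇ : ∀ {B : Set} (f : A → B) p {xs} → Unique (map f xs) → Unique (map f (filterᵇ p xs))
  Unique-map-filterᵇ f p u = AllPairs.map⁺ (AllPairs.filter⁺ (T? ∘ p) (AllPairs.map⁻ u))

  length-─ : ∀ {x : A} ys (x∈ys : x ∈ ys) → length ys ≡ suc (length (ys ─ x∈ys))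
  length-─ (y ∷ ys) (here _) = refl
  length-─ (y ∷ ys) (there x∈ys) = cong suc (length-─ ys x∈ys)

  ∈-─⁺ : ∀ {x z : A} ys (x∈ys : x ∈ ys) → z ∈ ys → z ≢ x → z ∈ (ys ─ x∈ys)
  ∈-─⁺ (y ∷ ys) (here refl) (here refl) z≢x = ⊥-elim (z≢x refl)
  ∈-─⁺ (y ∷ ys) (here refl) (there z∈ys) _ = z∈ys
  ∈-─⁺ (y ∷ ys) (there x∈ys) (here refl) _ = here refl
  ∈-─⁺ (y ∷ ys) (there x∈ys) (there z∈ys) z≢x = there (∈-─⁺ ys x∈ys z∈ys z≢x)

  Unique⇒length≤ : ∀ {xs ys : List A} → Unique xs → xs ⊆ ys → length xs ≤ length ys
  Unique⇒length≤ {[]} _ _ = z≤n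
  Unique⇒length≤ {x ∷ xs} {ys} u@(_ ∷ uxs) xs⊆ys =
    subst (suc (length xs) ≤_) (sym (length-─ ys x∈ys))
      (s≤s (Unique⇒length≤ uxs λ z∈xs → ∈-─⁺ ys x∈ys (xs⊆ys (there z∈xs))
                                          λ { refl → Unique[x∷xs]⇒x∉xs u z∈xs }))
    where
    x∈ys : x ∈ ys
    x∈ys = xs⊆ys (here refl)

  countᴸ : (A → Bool) → List A → ℕ
  countᴸ p xs = sum (map (λ v → if p v then 1 else 0) xs)

  countᴸ≡length-filterᵇ : ∀ p xs → countᴸ p xs ≡ length (filterᵇ p xs)
  countᴸ≡length-filterᵇ p [] = refl
  countᴸ≡length-filterᵇ p (x ∷ xs) with p x
  ... | true = cong suc (countᴸ≡length-filterᵇ p xs)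
  ... | false = countᴸ≡length-filterᵇ p xs

  countᴸ-+-not : ∀ p xs → countᴸ p xs + countᴸ (not ∘ p) xs ≡ length xs
  countᴸ-+-not p [] = refl
  countᴸ-+-not p (x ∷ xs) with p x
  ... | true = cong suc (countᴸ-+-not p xs)
  ... | false = trans (+-suc _ _) (cong suc (countᴸ-+-not p xs))

module _ {n : ℕ} where

  length-allFin : length (allFin n) ≡ n
  length-allFin = length-tabulate (λ i → i)

  Unique⇒length≤n : ∀ {xs : List (Fin n)} → Unique xs → length xs ≤ n
  Unique⇒length≤n {xs} u = subst (length xs ≤_) length-allFin (Unique⇒length≤ u λ {v} _ → ∈-allFin v)

  support : (Fin n → Bool) → List (Fin n)
  support p = filterᵇ p (allFin n)

  ∈-support⁺ : ∀ {p v} → p v ≡ true → v ∈ support p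
  ∈-support⁺ {p} {v} pv = ∈-filter⁺ (T? ∘ p) (∈-allFin v) (Equivalence.from T-≡ pv)

  ∈-support⁻ : ∀ {p v} → v ∈ support p → p v ≡ true
  ∈-support⁻ {p} v∈ = Equivalence.to T-≡ (proj₂ (∈-filter⁻ (T? ∘ p) {xs = allFin n} v∈))

  count≡length-support : ∀ p → count p ≡ length (support p)
  count≡length-support p = countᴸ≡length-filterᵇ p (allFin n)

  Unique⇒length≤count : ∀ {p xs} → Unique xs → (∀ {v} → v ∈ xs → p v ≡ true) → length xs ≤ count p
  Unique⇒length≤count {p} u all-p = subst (_ ≤_) (sym (count≡length-support p))
    (Unique⇒length≤ u λ v∈ → ∈-support⁺ {p} (all-p v∈))

  count≤length : ∀ {p xs} → (∀ {v} → p v ≡ true → v ∈ xs) → count p ≤ length xs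
  count≤length {p} p⊆xs = subst (_≤ _) (sym (count≡length-support p))
    (Unique⇒length≤ (filter⁺ (T? ∘ p) (allFin⁺ n)) λ v∈ → p⊆xs (∈-support⁻ {p} v∈))

  count-mono : ∀ {p q} → (∀ {v} → p v ≡ true → q v ≡ true) → count p ≤ count q
  count-mono {p} {q} p⇒q = subst (_≤ _) (sym (count≡length-support p))
    (Unique⇒length≤count {q} (filter⁺ (T? ∘ p) (allFin⁺ n)) λ v∈ → p⇒q (∈-support⁻ {p} v∈))

  count-+-not : ∀ p → count p + count (not ∘ p) ≡ n
  count-+-not p = trans (countᴸ-+-not p (allFin n)) length-allFin

  count>0⇒∃ : ∀ {p} → 0 < count p → ∃ λ v → p v ≡ true
  count>0⇒∃ {p} 0<count with any? (λ v → p v ≟ᵇ true)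
  ... | yes ∃v = ∃v
  ... | no ∄v = ⊥-elim (<⇒≱ 0<count (count≤length {xs = []} λ {v} pv → ⊥-elim (∄v (v , pv))))

  count-≡⇒ : ∀ {p q} → (∀ {v} → p v ≡ true → q v ≡ true) → count p ≡ count q →
             ∀ {v} → q v ≡ true → p v ≡ true
  count-≡⇒ {p} {q} p⇒q count≡ {v} qv with p v in pv
  ... | true = refl
  ... | false = ⊥-elim (<-irrefl count≡ (subst (_≤ count q) (cong suc (sym (count≡length-support p)))
      (Unique⇒length≤count {q} {v ∷ support p} (Unique-∷ v∉ (filter⁺ (T? ∘ p) (allFin⁺ n))) λ where
        (here refl) → qv
        (there w∈) → p⇒q (∈-support⁻ {p} w∈))))
    where
    v∉ : v ∉ support p
    v∉ v∈ with () ← trans (sym (∈-support⁻ {p} v∈)) pv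

+-mono-≤-≡⇒ : ∀ {a b c d} → a ≤ b → c ≤ d → a + c ≡ b + d → a ≡ b × c ≡ d
+-mono-≤-≡⇒ {a} {b} {c} {d} a≤b c≤d sum≡ = a≡b , +-cancelˡ-≡ b c d (trans (cong (_+ c) (sym a≡b)) sum≡)
  where
  a≡b : a ≡ b
  a≡b = ≤-antisym a≤b (+-cancelʳ-≤ c b a (≤-trans (+-monoʳ-≤ b c≤d) (≤-reflexive (sym sum≡))))

module _ {A : Set} where

  sum-map-+ : ∀ f g (xs : List A) → sum (map (λ v → f v + g v) xs) ≡ sum (map f xs) + sum (map g xs)
  sum-map-+ f g [] = refl
  sum-map-+ f g (x ∷ xs) =
    trans (cong (f x + g x +_) (sum-map-+ f g xs)) (+-interchange (f x) (g x) (sum (map f xs)) (sum (map g xs)))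

  sum-map-*ˡ : ∀ c f (xs : List A) → sum (map (λ v → c * f v) xs) ≡ c * sum (map f xs)
  sum-map-*ˡ c f [] = sym (*-zeroʳ c)
  sum-map-*ˡ c f (x ∷ xs) = trans (cong (c * f x +_) (sum-map-*ˡ c f xs)) (sym (*-distribˡ-+ c (f x) _))

  sum-map-mono : ∀ {f g} (xs : List A) → (∀ v → f v ≤ g v) → sum (map f xs) ≤ sum (map g xs)
  sum-map-mono [] f≤g = z≤n
  sum-map-mono (x ∷ xs) f≤g = +-mono-≤ (f≤g x) (sum-map-mono xs f≤g)

  sum-map-≡⇒ : ∀ {f g} (xs : List A) → (∀ v → f v ≤ g v) → sum (map f xs) ≡ sum (map g xs) →
               ∀ {v} → v ∈ xs → f v ≡ g v
  sum-map-≡⇒ (x ∷ xs) f≤g sum≡ (here refl) = proj₁ (+-mono-≤-≡⇒ (f≤g x) (sum-map-mono xs f≤g) sum≡)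
  sum-map-≡⇒ (x ∷ xs) f≤g sum≡ (there v∈) =
    sum-map-≡⇒ xs f≤g (proj₂ (+-mono-≤-≡⇒ (f≤g x) (sum-map-mono xs f≤g) sum≡)) v∈

sum-map-swap : ∀ {A B : Set} (f : A → B → ℕ) xs ys →
  sum (map (λ x → sum (map (f x) ys)) xs) ≡ sum (map (λ y → sum (map (λ x → f x y) xs)) ys)
sum-map-swap f [] ys = sym (sum-map-zero ys)
  where
  sum-map-zero : ∀ {B : Set} (ys : List B) → sum (map (λ _ → 0) ys) ≡ 0
  sum-map-zero [] = refl
  sum-map-zero (_ ∷ ys) = sum-map-zero ys
sum-map-swap f (x ∷ xs) ys =
  trans (cong (sum (map (f x) ys) +_) (sum-map-swap f xs ys)) (sym (sum-map-+ (f x) _ ys))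

∑ : ∀ {n} → (Fin n → ℕ) → ℕ
∑ {n} f = sum (map f (allFin n))

module _ {n : ℕ} where

  ∑-cong : ∀ {f g : Fin n → ℕ} → (∀ u → f u ≡ g u) → ∑ f ≡ ∑ g
  ∑-cong f≡g = cong sum (map-cong f≡g (allFin n))

  ∑-+ : ∀ (f g : Fin n → ℕ) → ∑ (λ u → f u + g u) ≡ ∑ f + ∑ g
  ∑-+ f g = sum-map-+ f g (allFin n)

  ∑-*ˡ : ∀ c (f : Fin n → ℕ) → ∑ (λ u → c * f u) ≡ c * ∑ f
  ∑-*ˡ c f = sum-map-*ˡ c f (allFin n)

  ∑-mono : ∀ {f g : Fin n → ℕ} → (∀ u → f u ≤ g u) → ∑ f ≤ ∑ g
  ∑-mono = sum-map-mono (allFin n)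

  ∑-≡⇒ : ∀ {f g : Fin n → ℕ} → (∀ u → f u ≤ g u) → ∑ f ≡ ∑ g → ∀ u → f u ≡ g u
  ∑-≡⇒ f≤g sum≡ u = sum-map-≡⇒ (allFin n) f≤g sum≡ (∈-allFin u)

  ∑∑-+ : ∀ (f g : Fin n → Fin n → ℕ) →
        ∑ (λ u → ∑ λ v → f u v + g u v) ≡ ∑ (λ u → ∑ (f u)) + ∑ (λ u → ∑ (g u))
  ∑∑-+ f g = trans (∑-cong λ u → ∑-+ (f u) (g u)) (∑-+ (λ u → ∑ (f u)) (λ u → ∑ (g u)))

  ∑-swap : ∀ (f : Fin n → Fin n → ℕ) → ∑ (λ u → ∑ (f u)) ≡ ∑ (λ v → ∑ λ u → f u v)
  ∑-swap f = sum-map-swap f (allFin n) (allFin n)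

𝟙 : Bool → ℕ
𝟙 b = if b then 1 else 0

<ᵇ-trichotomy : ∀ a b →
  ((a <ᵇ b) ≡ true × (b <ᵇ a) ≡ false) ⊎ ((a <ᵇ b) ≡ false × (b <ᵇ a) ≡ true) ⊎ a ≡ b
<ᵇ-trichotomy zero zero = inj₂ (inj₂ refl)
<ᵇ-trichotomy zero (suc b) = inj₁ (refl , refl)
<ᵇ-trichotomy (suc a) zero = inj₂ (inj₁ (refl , refl))
<ᵇ-trichotomy (suc a) (suc b) with <ᵇ-trichotomy a b
... | inj₁ lt = inj₁ lt
... | inj₂ (inj₁ gt) = inj₂ (inj₁ gt)
... | inj₂ (inj₂ a≡b) = inj₂ (inj₂ (cong suc a≡b))

module EdgeSums {n : ℕ} (G : Graph n) where

  edgeTerm : (Fin n → Fin n → ℕ) → Fin n → Fin n → ℕ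
  edgeTerm g u v = if adj G u v then (if toℕ u <ᵇ toℕ v then g u v else 0) else 0

  edgeSum : (Fin n → Fin n → ℕ) → ℕ
  edgeSum g = ∑ λ u → ∑ (edgeTerm g u)

  edgeTerm-mono : ∀ {g g'} → (∀ {u v} → adj G u v ≡ true → g u v ≤ g' u v) →
                  ∀ u v → edgeTerm g u v ≤ edgeTerm g' u v
  edgeTerm-mono g≤g' u v with adj G u v in uv
  ... | false = z≤n
  ... | true with toℕ u <ᵇ toℕ v
  ...   | true = g≤g' uv
  ...   | false = z≤n

  edgeSum-mono : ∀ {g g'} → (∀ {u v} → adj G u v ≡ true → g u v ≤ g' u v) → edgeSum g ≤ edgeSum g'
  edgeSum-mono g≤g' = ∑-mono λ u → ∑-mono (edgeTerm-mono g≤g' u)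

  edgeSum-cong : ∀ {g g'} → (∀ {u v} → adj G u v ≡ true → g u v ≡ g' u v) → edgeSum g ≡ edgeSum g'
  edgeSum-cong g≡g' =
    ≤-antisym (edgeSum-mono (≤-reflexive ∘ g≡g')) (edgeSum-mono (≤-reflexive ∘ sym ∘ g≡g'))

  edgeSum-≡⇒ : ∀ {g g'} → (∀ {u v} → adj G u v ≡ true → g u v ≤ g' u v) → edgeSum g ≡ edgeSum g' →
               ∀ {u v} → adj G u v ≡ true → (toℕ u <ᵇ toℕ v) ≡ true → g u v ≡ g' u v
  edgeSum-≡⇒ {g} {g'} g≤g' sum≡ {u} {v} uv u<v = subst₂ _≡_ (at g) (at g') term≡
    where
    term≡ : edgeTerm g u v ≡ edgeTerm g' u v
    term≡ = ∑-≡⇒ (edgeTerm-mono g≤g' u) (∑-≡⇒ (λ u → ∑-mono (edgeTerm-mono g≤g' u)) sum≡ u) v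
    at : ∀ h → edgeTerm h u v ≡ h u v
    at h rewrite uv | u<v = refl

  edgeTerm-+ : ∀ g g' u v → edgeTerm g u v + edgeTerm g' u v ≡ edgeTerm (λ a b → g a b + g' a b) u v
  edgeTerm-+ g g' u v with adj G u v
  ... | false = refl
  ... | true with toℕ u <ᵇ toℕ v
  ...   | true = refl
  ...   | false = refl

  weight-split : ∀ (w : Fin n → ℕ) u v →
    w u * 𝟙 (adj G u v) ≡ edgeTerm (λ a _ → w a) u v + edgeTerm (λ _ b → w b) v u
  weight-split w u v rewrite Graph.sym G v u with adj G u v in uv
  ... | false = *-zeroʳ (w u)
  ... | true with <ᵇ-trichotomy (toℕ u) (toℕ v)
  ...   | inj₁ (u<v , v≮u) rewrite u<v | v≮u = trans (*-identityʳ (w u)) (sym (+-identityʳ (w u)))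
  ...   | inj₂ (inj₁ (u≮v , v<u)) rewrite u≮v | v<u = *-identityʳ (w u)
  ...   | inj₂ (inj₂ u≡v) with refl ← toℕ-injective u≡v with () ← trans (sym uv) (irrefl G u)

  handshake : ∀ (w : Fin n → ℕ) → ∑ (λ u → w u * degree G u) ≡ edgeSum (λ u v → w u + w v)
  handshake w = begin
    ∑ (λ u → w u * degree G u)
      ≡⟨ ∑-cong (λ u → ∑-*ˡ (w u) (λ v → 𝟙 (adj G u v))) ⟨
    ∑ (λ u → ∑ λ v → w u * 𝟙 (adj G u v))
      ≡⟨ ∑-cong (λ u → ∑-cong (weight-split w u)) ⟩
    ∑ (λ u → ∑ λ v → edgeTerm wˡ u v + edgeTerm wʳ v u)
      ≡⟨ ∑∑-+ (edgeTerm wˡ) (λ u v → edgeTerm wʳ v u) ⟩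
    edgeSum wˡ + ∑ (λ u → ∑ λ v → edgeTerm wʳ v u)
      ≡⟨ cong (edgeSum wˡ +_) (∑-swap λ u v → edgeTerm wʳ v u) ⟩
    edgeSum wˡ + edgeSum wʳ
      ≡⟨ ∑∑-+ (edgeTerm wˡ) (edgeTerm wʳ) ⟨
    ∑ (λ u → ∑ λ v → edgeTerm wˡ u v + edgeTerm wʳ u v)
      ≡⟨ ∑-cong (λ u → ∑-cong (edgeTerm-+ wˡ wʳ u)) ⟩
    edgeSum (λ u v → w u + w v) ∎
    where
    open ≡-Reasoning
    wˡ wʳ : Fin n → Fin n → ℕ
    wˡ a _ = w a
    wʳ _ b = w b

Independent : ∀ {n} → Graph n → (Fin n → Bool) → Set
Independent G I = ∀ {u v} → I u ≡ true → I v ≡ true → adj G u v ≡ false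

module Paths {n : ℕ} (G : Graph n) where

  open DecMembership (_≟ᶠ_ {n}) using (_∈?_)

  Adj : Fin n → Fin n → Set
  Adj u v = adj G u v ≡ true

  Adj-irrefl : ∀ {u} → ¬ Adj u u
  Adj-irrefl {u} uu with () ← trans (sym uu) (irrefl G u)

  Adj-sym : ∀ {u v} → Adj u v → Adj v u
  Adj-sym {u} {v} uv = trans (Graph.sym G v u) uv

  -- Paths may repeat vertices; simplicity is the separate predicate Unique (vertices p).
  infixr 5 _∷⟨_⟩_

  data Path : Fin n → Fin n → Set where
    end    : ∀ x → Path x x
    _∷⟨_⟩_ : ∀ x {y z} → Adj x y → Path y z → Path x z

  vertices : ∀ {a b} → Path a b → List (Fin n)
  vertices (end x) = x ∷ []
  vertices (x ∷⟨ _ ⟩ p) = x ∷ vertices p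

  start∈ : ∀ {a b} (p : Path a b) → a ∈ vertices p
  start∈ (end x) = here refl
  start∈ (x ∷⟨ _ ⟩ p) = here refl

  end∈ : ∀ {a b} (p : Path a b) → b ∈ vertices p
  end∈ (end x) = here refl
  end∈ (x ∷⟨ _ ⟩ p) = there (end∈ p)

  1≤length : ∀ {a b} (p : Path a b) → 1 ≤ length (vertices p)
  1≤length (end x) = s≤s z≤n
  1≤length (x ∷⟨ _ ⟩ p) = s≤s z≤n

  _++⟨_⟩_ : ∀ {a b c d} → Path a b → Adj b c → Path c d → Path a d
  end x ++⟨ e ⟩ q = x ∷⟨ e ⟩ q
  (x ∷⟨ e′ ⟩ p) ++⟨ e ⟩ q = x ∷⟨ e′ ⟩ (p ++⟨ e ⟩ q)

  vertices-++⟨⟩ : ∀ {a b c d} (p : Path a b) (e : Adj b c) (q : Path c d) →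
                  vertices (p ++⟨ e ⟩ q) ≡ vertices p ++ vertices q
  vertices-++⟨⟩ (end x) e q = refl
  vertices-++⟨⟩ (x ∷⟨ _ ⟩ p) e q = cong (x ∷_) (vertices-++⟨⟩ p e q)

  reversePath : ∀ {a b} → Path a b → Path b a
  reversePath (end x) = end x
  reversePath (x ∷⟨ e ⟩ p) = reversePath p ++⟨ Adj-sym e ⟩ end x

  vertices-reversePath : ∀ {a b} (p : Path a b) → vertices (reversePath p) ≡ reverse (vertices p)
  vertices-reversePath (end x) = refl
  vertices-reversePath (x ∷⟨ e ⟩ p) = trans (vertices-++⟨⟩ (reversePath p) (Adj-sym e) (end x))
    (trans (cong (_++ x ∷ []) (vertices-reversePath p)) (sym (unfold-reverse x (vertices p))))

  length-++⟨⟩ : ∀ {a b c d} (p : Path a b) (e : Adj b c) (q : Path c d) →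
                length (vertices (p ++⟨ e ⟩ q)) ≡ length (vertices p) + length (vertices q)
  length-++⟨⟩ p e q = trans (cong length (vertices-++⟨⟩ p e q)) (length-++ (vertices p))

  length-reversePath : ∀ {a b} (p : Path a b) → length (vertices (reversePath p)) ≡ length (vertices p)
  length-reversePath p = trans (cong length (vertices-reversePath p)) (length-reverse (vertices p))

  _⨾_ : ∀ {a b c} → Path a b → Path b c → Path a c
  end x ⨾ q = q
  (x ∷⟨ e ⟩ p) ⨾ q = x ∷⟨ e ⟩ (p ⨾ q)

  ∈-⨾⁻ : ∀ {a b c} (p : Path a b) (q : Path b c) {z} → z ∈ vertices (p ⨾ q) → z ∈ vertices p ⊎ z ∈ vertices q
  ∈-⨾⁻ (end x) q z∈ = inj₂ z∈
  ∈-⨾⁻ (x ∷⟨ e ⟩ p) q (here refl) = inj₁ (here refl)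
  ∈-⨾⁻ (x ∷⟨ e ⟩ p) q (there z∈) with ∈-⨾⁻ p q z∈
  ... | inj₁ z∈p = inj₁ (there z∈p)
  ... | inj₂ z∈q = inj₂ z∈q

  suffixFrom : ∀ {a b x} (p : Path a b) → x ∈ vertices p →
               Σ (Path x b) λ q → ∃ λ pre → vertices p ≡ pre ++ vertices q
  suffixFrom (end x) (here refl) = end x , [] , refl
  suffixFrom (x ∷⟨ e ⟩ p) (here refl) = x ∷⟨ e ⟩ p , [] , refl
  suffixFrom (x ∷⟨ e ⟩ p) (there x∈) with suffixFrom p x∈
  ... | q , pre , eq = q , x ∷ pre , cong (x ∷_) eq

  suffixFrom-⊆ : ∀ {a b x} (p : Path a b) (x∈ : x ∈ vertices p) → vertices (proj₁ (suffixFrom p x∈)) ⊆ vertices p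
  suffixFrom-⊆ p x∈ with suffixFrom p x∈
  ... | q , pre , eq = λ z∈ → subst (_ ∈_) (sym eq) (∈-++⁺ʳ pre z∈)

  simplify : ∀ {a b} (p : Path a b) → Σ (Path a b) λ q → Unique (vertices q) × vertices q ⊆ vertices p
  simplify (end x) = end x , [] ∷ [] , λ z∈ → z∈
  simplify (x ∷⟨ e ⟩ p) with simplify p
  ... | q , uq , q⊆p with x ∈? vertices q
  ...   | yes x∈q = proj₁ (suffixFrom q x∈q) , suffix-unique , there ∘ q⊆p ∘ suffixFrom-⊆ q x∈q
    where
    suffix-unique : Unique (vertices (proj₁ (suffixFrom q x∈q)))
    suffix-unique with suffixFrom q x∈q
    ... | _ , pre , eq = proj₁ (proj₂ (Unique-++⁻ pre (subst Unique eq uq)))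
  ...   | no x∉q = x ∷⟨ e ⟩ q , Unique-∷ x∉q uq , λ where
    (here refl) → here refl
    (there z∈) → there (q⊆p z∈)

  steps : ∀ {a b} → Path a b → List (Fin n × Fin n)
  steps (end x) = []
  steps (_∷⟨_⟩_ x {y} _ p) = (x , y) ∷ steps p

  steps-++⟨⟩ : ∀ {a b c d} (p : Path a b) (e : Adj b c) (q : Path c d) →
               steps (p ++⟨ e ⟩ q) ≡ steps p ++ (b , c) ∷ steps q
  steps-++⟨⟩ (end x) e q = refl
  steps-++⟨⟩ (x ∷⟨ _ ⟩ p) e q = cong (_ ∷_) (steps-++⟨⟩ p e q)

  splitAt : ∀ {a b x y} (p : Path a b) → (x , y) ∈ steps p →
            Σ (Path a x) λ p₁ → Σ (Path y b) λ p₂ → Σ (Adj x y) λ e → p ≡ p₁ ++⟨ e ⟩ p₂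
  splitAt (x ∷⟨ e ⟩ p) (here refl) = end x , p , e , refl
  splitAt (x ∷⟨ e ⟩ p) (there xy∈) with splitAt p xy∈
  ... | p₁ , p₂ , e′ , refl = x ∷⟨ e ⟩ p₁ , p₂ , e′ , refl

  start∷map-proj₂-steps : ∀ {a b} (p : Path a b) → a ∷ map proj₂ (steps p) ≡ vertices p
  start∷map-proj₂-steps (end x) = refl
  start∷map-proj₂-steps (x ∷⟨ e ⟩ p) = cong (x ∷_) (start∷map-proj₂-steps p)

  ∈-vertices⇒ : ∀ {a b z} (p : Path a b) → z ∈ vertices p → z ≡ b ⊎ z ∈ map proj₁ (steps p)
  ∈-vertices⇒ (end x) (here refl) = inj₁ refl
  ∈-vertices⇒ (x ∷⟨ e ⟩ p) (here refl) = inj₂ (here refl)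
  ∈-vertices⇒ (x ∷⟨ e ⟩ p) (there z∈) with ∈-vertices⇒ p z∈
  ... | inj₁ z≡b = inj₁ z≡b
  ... | inj₂ z∈′ = inj₂ (there z∈′)

  -- A cycle of length 2 (an edge traversed back and forth) is admitted: it is the seed
  -- of the extension process.
  record Cycle : Set where
    constructor cycle
    field
      {first last} : Fin n
      path    : Path first last
      closing : Adj last first
      unique  : Unique (vertices path)

  open Cycle public

  onCycle : Cycle → List (Fin n)
  onCycle C = vertices (path C)

  cycleLength : Cycle → ℕ
  cycleLength C = length (onCycle C)

  cyclicSteps : Cycle → List (Fin n × Fin n)
  cyclicSteps C = (last C , first C) ∷ steps (path C)

  map-proj₂-cyclicSteps : ∀ C → map proj₂ (cyclicSteps C) ≡ onCycle C
  map-proj₂-cyclicSteps C = start∷map-proj₂-steps (path C)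

  onCycle⇒∈-map-proj₁ : ∀ C {z} → z ∈ onCycle C → z ∈ map proj₁ (cyclicSteps C)
  onCycle⇒∈-map-proj₁ C z∈ with ∈-vertices⇒ (path C) z∈
  ... | inj₁ refl = here refl
  ... | inj₂ z∈′ = there z∈′

  cycleLength≤n : ∀ C → cycleLength C ≤ n
  cycleLength≤n C = Unique⇒length≤n (unique C)

  edge-cycle : ∀ {u v} → Adj u v → Cycle
  edge-cycle {u} {v} uv = cycle (u ∷⟨ uv ⟩ end v) (Adj-sym uv) (Unique-∷ u∉ ([] ∷ []))
    where
    u∉ : u ∉ v ∷ []
    u∉ (here refl) = Adj-irrefl uv

  record Rotation (C : Cycle) (x y : Fin n) : Set where
    field
      rotated        : Path y x
      rotated-unique : Unique (vertices rotated)
      vertices↭      : vertices rotated ↭ onCycle C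
      steps↭         : (x , y) ∷ steps rotated ↭ cyclicSteps C

  rotate : ∀ C {x y} → (x , y) ∈ cyclicSteps C → Rotation C x y
  rotate (cycle p cl u) (here refl) = record
    { rotated = p ; rotated-unique = u ; vertices↭ = ↭-refl ; steps↭ = ↭-refl }
  rotate (cycle p cl u) (there xy∈) with splitAt p xy∈
  ... | p₁ , p₂ , e , refl = record
    { rotated = p₂ ++⟨ cl ⟩ p₁
    ; rotated-unique = subst Unique (sym (vertices-++⟨⟩ p₂ cl p₁))
        (Unique-++-comm (vertices p₁) (subst Unique (vertices-++⟨⟩ p₁ e p₂) u))
    ; vertices↭ = subst₂ _↭_ (sym (vertices-++⟨⟩ p₂ cl p₁)) (sym (vertices-++⟨⟩ p₁ e p₂))
        (++-comm (vertices p₂) (vertices p₁))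
    ; steps↭ = subst₂ (λ s s′ → _ ∷ s ↭ _ ∷ s′) (sym (steps-++⟨⟩ p₂ cl p₁)) (sym (steps-++⟨⟩ p₁ e p₂))
        (++-comm (_ ∷ steps p₂) (_ ∷ steps p₁))
    }

  lookupOr : List (Fin n) → ℕ → Fin n → Fin n
  lookupOr [] i d = d
  lookupOr (x ∷ xs) zero d = x
  lookupOr (x ∷ xs) (suc i) d = lookupOr xs i d

  lookupOr-∈ : ∀ xs i d → i < length xs → lookupOr xs i d ∈ xs
  lookupOr-∈ (x ∷ xs) zero d _ = here refl
  lookupOr-∈ (x ∷ xs) (suc i) d (s≤s i<) = there (lookupOr-∈ xs i d i<)

  lookupOr-injective : ∀ {xs} → Unique xs → ∀ {i j} d → i < length xs → j < length xs →
                       lookupOr xs i d ≡ lookupOr xs j d → i ≡ j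
  lookupOr-injective {x ∷ xs} u {zero} {zero} d _ _ _ = refl
  lookupOr-injective {x ∷ xs} u {zero} {suc j} d _ (s≤s j<) x≡ =
    ⊥-elim (Unique[x∷xs]⇒x∉xs u (subst (_∈ xs) (sym x≡) (lookupOr-∈ xs j d j<)))
  lookupOr-injective {x ∷ xs} u {suc i} {zero} d (s≤s i<) _ x≡ =
    ⊥-elim (Unique[x∷xs]⇒x∉xs u (subst (_∈ xs) x≡ (lookupOr-∈ xs i d i<)))
  lookupOr-injective {x ∷ xs} (_ ∷ u) {suc i} {suc j} d (s≤s i<) (s≤s j<) x≡ =
    cong suc (lookupOr-injective u d i< j< x≡)

  lookupOr-start : ∀ {a b} (p : Path a b) d → lookupOr (vertices p) 0 d ≡ a
  lookupOr-start (end x) d = refl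
  lookupOr-start (x ∷⟨ _ ⟩ p) d = refl

  lookupOr-end : ∀ {a b} (p : Path a b) {i} d → suc i ≡ length (vertices p) → lookupOr (vertices p) i d ≡ b
  lookupOr-end (end x) {zero} d _ = refl
  lookupOr-end (x ∷⟨ _ ⟩ end y) {suc zero} d _ = refl
  lookupOr-end (x ∷⟨ _ ⟩ (y ∷⟨ e ⟩ p)) {suc i} d len≡ = lookupOr-end (y ∷⟨ e ⟩ p) d (suc-injective len≡)

  lookupOr-adjacent : ∀ {a b} (p : Path a b) {i} d → suc (suc i) ≤ length (vertices p) →
                      Adj (lookupOr (vertices p) i d) (lookupOr (vertices p) (suc i) d)
  lookupOr-adjacent (x ∷⟨ e ⟩ end y) {zero} d _ = e
  lookupOr-adjacent (x ∷⟨ e ⟩ (y ∷⟨ _ ⟩ p)) {zero} d _ = e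
  lookupOr-adjacent (x ∷⟨ _ ⟩ (y ∷⟨ e ⟩ p)) {suc i} d (s≤s i<) = lookupOr-adjacent (y ∷⟨ e ⟩ p) d i<
  lookupOr-adjacent (x ∷⟨ e ⟩ end y) {suc i} d (s≤s (s≤s ()))
  lookupOr-adjacent (end x) d (s≤s ())

  spanning⇒Hamiltonian : ∀ C → cycleLength C ≡ n → Hamiltonian G
  spanning⇒Hamiltonian (cycle {a} {b} p cl u) len≡n = σ , σ-injective , σ-consecutive , σ-closing
    where
    σ : Fin n → Fin n
    σ i = lookupOr (vertices p) (toℕ i) a
    in-range : ∀ (i : Fin n) → toℕ i < length (vertices p)
    in-range i = subst (toℕ i <_) (sym len≡n) (toℕ<n i)
    σ-injective : ∀ {i j} → σ i ≡ σ j → i ≡ j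
    σ-injective {i} {j} σ≡ = toℕ-injective (lookupOr-injective u a (in-range i) (in-range j) σ≡)
    σ-consecutive : ∀ i j → suc (toℕ i) ≡ toℕ j → Adj (σ i) (σ j)
    σ-consecutive i j i+1≡j rewrite sym i+1≡j = lookupOr-adjacent p a (subst (_< _) (sym i+1≡j) (in-range j))
    σ-closing : ∀ i j → suc (toℕ i) ≡ n → toℕ j ≡ 0 → Adj (σ i) (σ j)
    σ-closing i j i-last j≡0 rewrite j≡0 | lookupOr-start p a | lookupOr-end p a (trans i-last (sym len≡n)) = cl

+-<-rotate : ∀ a b {p} → 1 ≤ p → a + b < b + (p + a)
+-<-rotate a b {p} 1≤p = subst (_< b + (p + a)) (+-comm b a) (+-monoʳ-< b (m<n+m a 1≤p))

module Component {n : ℕ} (G : Graph n) (C : Paths.Cycle G) (h : Fin n) (h∉C : h ∉ Paths.onCycle G C) where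

  open Paths G
  open DecMembership (_≟ᶠ_ {n}) using (_∈?_; _∉?_)

  Outside : ∀ {a b} → Path a b → Set
  Outside p = ∀ {z} → z ∈ vertices p → z ∉ onCycle C

  Grows : (Fin n → Bool) → Fin n → Set
  Grows R v = R v ≡ true ⊎ (v ∉ onCycle C × ∃ λ u → Adj v u × R u ≡ true)

  grows? : ∀ R v → Dec (Grows R v)
  grows? R v = R v ≟ᵇ true ⊎-dec (v ∉? onCycle C ×-dec any? λ u → adj G v u ≟ᵇ true ×-dec R u ≟ᵇ true)

  -- Breadth-first search: reaches t v iff v is joined to h by a path outside C with at most t
  -- edges. The component of h must be a Boolean vertex set to be used with KConnected.
  reaches : ℕ → Fin n → Bool
  reaches zero v = does (v ≟ᶠ h)
  reaches (suc t) v = does (grows? (reaches t) v)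

  reaches-sound : ∀ t {v} → reaches t v ≡ true → Σ (Path v h) Outside
  reaches-sound zero {v} r with refl ← dec-true⁻¹ (v ≟ᶠ h) r = end h , λ { (here refl) → h∉C }
  reaches-sound (suc t) {v} r with dec-true⁻¹ (grows? (reaches t) v) r
  ... | inj₁ r′ = reaches-sound t r′
  ... | inj₂ (v∉C , u , vu , r′) with reaches-sound t r′
  ...   | w , out = _ ∷⟨ vu ⟩ w , λ { (here refl) → v∉C ; (there z∈) → out z∈ }

  reaches-h : ∀ t → reaches t h ≡ true
  reaches-h zero = dec-true (h ≟ᶠ h) refl
  reaches-h (suc t) = dec-true (grows? (reaches t) h) (inj₁ (reaches-h t))

  reaches-complete : ∀ t {v} (w : Path v h) → Outside w → length (vertices w) ≤ suc t → reaches t v ≡ true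
  reaches-complete t (end _) _ _ = reaches-h t
  reaches-complete zero (v ∷⟨ _ ⟩ w) _ (s≤s len≤) = ⊥-elim (<⇒≱ (1≤length w) len≤)
  reaches-complete (suc t) (v ∷⟨ vu ⟩ w) out (s≤s len≤) =
    dec-true (grows? (reaches t) v) (inj₂ (out (here refl) , _ , vu , reaches-complete t w (out ∘ there) len≤))

  inH : Fin n → Bool
  inH = reaches n

  inH-h : inH h ≡ true
  inH-h = reaches-h n

  inH-sound : ∀ {v} → inH v ≡ true → Σ (Path v h) Outside
  inH-sound = reaches-sound n

  inH⇒∉C : ∀ {v} → inH v ≡ true → v ∉ onCycle C
  inH⇒∉C hv with inH-sound hv
  ... | w , out = out (start∈ w)

  inH-complete : ∀ {v} (w : Path v h) → Outside w → inH v ≡ true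
  inH-complete w out with simplify w
  ... | q , uq , q⊆w = reaches-complete n q (out ∘ q⊆w)
    (m≤n⇒m≤1+n (Unique⇒length≤n uq))

  inH-closed : ∀ {u v} → inH u ≡ true → Adj u v → v ∉ onCycle C → inH v ≡ true
  inH-closed hu uv v∉C with inH-sound hu
  ... | w , out = inH-complete (_ ∷⟨ Adj-sym uv ⟩ w) λ { (here refl) → v∉C ; (there z∈) → out z∈ }

  inH-along : ∀ {v z} (w : Path v h) → Outside w → z ∈ vertices w → inH z ≡ true
  inH-along w out z∈ = inH-complete (proj₁ (suffixFrom w z∈)) (out ∘ suffixFrom-⊆ w z∈)

  inH-path : ∀ {u₁ u₂} → inH u₁ ≡ true → inH u₂ ≡ true →
             Σ (Path u₁ u₂) λ P → Unique (vertices P) × (∀ {z} → z ∈ vertices P → inH z ≡ true)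
  inH-path h₁ h₂ with inH-sound h₁ | inH-sound h₂
  ... | w₁ , out₁ | w₂ , out₂ with simplify (w₁ ⨾ reversePath w₂)
  ...   | P , uP , P⊆ = P , uP , λ z∈ → along (∈-⨾⁻ w₁ (reversePath w₂) (P⊆ z∈))
    where
    along : ∀ {z} → z ∈ vertices w₁ ⊎ z ∈ vertices (reversePath w₂) → inH z ≡ true
    along (inj₁ z∈) = inH-along w₁ out₁ z∈
    along (inj₂ z∈) = inH-along w₂ out₂ (reverse⁻ (subst (_ ∈_) (vertices-reversePath w₂) z∈))

module Extension {n : ℕ} (G : Graph n) (k : ℕ) (k-conn : KConnected k G)
                 (C : Paths.Cycle G) (h : Fin n) (h∉C : h ∉ Paths.onCycle G C) where

  open Paths G
  open Component G C h h∉C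
  open DecMembership (_≟ᶠ_ {n}) using (_∈?_)

  Attached : Fin n → Set
  Attached x = x ∈ onCycle C × ∃ λ u → Adj x u × inH u ≡ true

  attached? : ∀ x → Dec (Attached x)
  attached? x = x ∈? onCycle C ×-dec any? λ u → adj G x u ≟ᵇ true ×-dec inH u ≟ᵇ true

  attached : Fin n → Bool
  attached x = does (attached? x)

  LongerCycle : Set
  LongerCycle = Σ Cycle λ C′ → cycleLength C < cycleLength C′

  H∩C-empty : ∀ {P : List (Fin n)} {xs} → (∀ {z} → z ∈ P → inH z ≡ true) → xs ↭ onCycle C → Disjoint P xs
  H∩C-empty P⊆H xs↭C (z∈P , z∈xs) = inH⇒∉C (P⊆H z∈P) (∈-resp-↭ xs↭C z∈xs)

  longer-via-consecutive : ∀ {x y} → (x , y) ∈ cyclicSteps C → Attached x → Attached y → LongerCycle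
  longer-via-consecutive xy∈ (_ , u₁ , xu₁ , h₁) (_ , u₂ , yu₂ , h₂) with inH-path h₁ h₂
  ... | P , uP , P⊆H = cycle (rotated ++⟨ xu₁ ⟩ P) (Adj-sym yu₂) unique′ , longer
    where
    open Rotation (rotate C xy∈)
    unique′ : Unique (vertices (rotated ++⟨ xu₁ ⟩ P))
    unique′ = subst Unique (sym (vertices-++⟨⟩ rotated xu₁ P))
      (++⁺ rotated-unique uP λ (z∈r , z∈P) → H∩C-empty P⊆H vertices↭ (z∈P , z∈r))
    longer : cycleLength C < length (vertices (rotated ++⟨ xu₁ ⟩ P))
    longer = subst₂ _<_ (↭-length vertices↭) (sym (length-++⟨⟩ rotated xu₁ P))
      (m<m+n (length (vertices rotated)) (1≤length P))

  longer-via-adjacent-successors : ∀ {x₁ y₁ x₂ y₂} → (x₁ , y₁) ∈ cyclicSteps C → (x₂ , y₂) ∈ cyclicSteps C →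
    Attached x₁ → Attached x₂ → y₁ ≢ y₂ → Adj y₁ y₂ → LongerCycle
  longer-via-adjacent-successors {y₁ = y₁} {y₂ = y₂} xy₁∈ xy₂∈ (_ , u₁ , x₁u₁ , h₁) (_ , u₂ , x₂u₂ , h₂) y₁≢y₂ y₁y₂
    with inH-path h₁ h₂ | ∈-resp-↭ (↭-sym (Rotation.steps↭ (rotate C xy₁∈))) xy₂∈
  ... | _ | here refl = ⊥-elim (y₁≢y₂ refl)
  ... | P , uP , P⊆H | there xy₂∈r with splitAt (Rotation.rotated (rotate C xy₁∈)) xy₂∈r
  ...   | q₁ , q₂ , e , rotated≡ = cycle path′ y₁y₂ unique′ , longer
    where
    open Rotation (rotate C xy₁∈)
    -- y₂ ⋯ x₁ along C, through H to x₂, back along C to y₁; closed by the edge y₁ y₂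
    path′ : Path y₂ y₁
    path′ = q₂ ++⟨ x₁u₁ ⟩ (P ++⟨ Adj-sym x₂u₂ ⟩ reversePath q₁)
    vertices-rotated : vertices rotated ≡ vertices q₁ ++ vertices q₂
    vertices-rotated = trans (cong vertices rotated≡) (vertices-++⟨⟩ q₁ e q₂)
    vertices-path′ : vertices path′ ≡ vertices q₂ ++ vertices P ++ reverse (vertices q₁)
    vertices-path′ = trans (vertices-++⟨⟩ q₂ x₁u₁ _) (cong (vertices q₂ ++_)
      (trans (vertices-++⟨⟩ P (Adj-sym x₂u₂) (reversePath q₁)) (cong (vertices P ++_) (vertices-reversePath q₁))))
    unique′ : Unique (vertices path′)
    unique′ = subst Unique (sym vertices-path′)
      (Unique-splice {xs = vertices q₁} (subst Unique vertices-rotated rotated-unique) uP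
        (H∩C-empty P⊆H (subst (_↭ onCycle C) vertices-rotated vertices↭)))
    longer : cycleLength C < length (vertices path′)
    longer = begin-strict
      cycleLength C                                    ≡⟨ ↭-length vertices↭ ⟨
      length (vertices rotated)                        ≡⟨ cong (length ∘ vertices) rotated≡ ⟩
      length (vertices (q₁ ++⟨ e ⟩ q₂))                ≡⟨ length-++⟨⟩ q₁ e q₂ ⟩
      length (vertices q₁) + length (vertices q₂)      <⟨ +-<-rotate (length (vertices q₁)) _ (1≤length P) ⟩
      length (vertices q₂) + (length (vertices P) + length (vertices q₁))
                                                       ≡⟨ cong (λ l → length (vertices q₂) + (length (vertices P) + l))
                                                               (length-reversePath q₁) ⟨
      length (vertices q₂) + (length (vertices P) + length (vertices (reversePath q₁)))
                                                       ≡⟨ cong (length (vertices q₂) +_) (length-++⟨⟩ P _ _) ⟨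
      length (vertices q₂) + length (vertices (P ++⟨ Adj-sym x₂u₂ ⟩ reversePath q₁))
                                                       ≡⟨ length-++⟨⟩ q₂ x₁u₁ _ ⟨
      length (vertices path′) ∎
      where open ≤-Reasoning

  NoConsecutive : Set
  NoConsecutive = ∀ {x y} → (x , y) ∈ cyclicSteps C → ¬ (Attached x × Attached y)

  NoAdjacentSuccessors : Set
  NoAdjacentSuccessors = ∀ {x₁ y₁ x₂ y₂} → (x₁ , y₁) ∈ cyclicSteps C → (x₂ , y₂) ∈ cyclicSteps C →
                         ¬ (Attached x₁ × Attached x₂ × y₁ ≢ y₂ × Adj y₁ y₂)

  successors : List (Fin n)
  successors = map proj₂ (filterᵇ (attached ∘ proj₁) (cyclicSteps C))

  ∈-successors⁻ : ∀ {y} → y ∈ successors → ∃ λ x → (x , y) ∈ cyclicSteps C × Attached x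
  ∈-successors⁻ y∈ with ∈-map⁻ proj₂ y∈
  ... | (x , y) , xy∈ , refl with ∈-filter⁻ (T? ∘ attached ∘ proj₁) {xs = cyclicSteps C} xy∈
  ...   | xy∈C , ax = x , xy∈C , dec-true⁻¹ (attached? x) (Equivalence.to T-≡ ax)

  successor∈C : ∀ {x y} → (x , y) ∈ cyclicSteps C → y ∈ onCycle C
  successor∈C xy∈ = subst (_ ∈_) (map-proj₂-cyclicSteps C) (∈-map⁺ proj₂ xy∈)

  successors-unique : Unique successors
  successors-unique = Unique-map-filterᵇ proj₂ (attached ∘ proj₁)
    (subst Unique (sym (map-proj₂-cyclicSteps C)) (unique C))

  count-attached≤ : count attached ≤ length successors
  count-attached≤ = subst (count attached ≤_) (trans (length-map proj₁ attachedSteps) (sym (length-map proj₂ attachedSteps)))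
    (count≤length {p = attached} λ {x} ax → first∈ (onCycle⇒∈-map-proj₁ C (proj₁ (dec-true⁻¹ (attached? x) ax))) ax)
    where
    attachedSteps : List (Fin n × Fin n)
    attachedSteps = filterᵇ (attached ∘ proj₁) (cyclicSteps C)
    first∈ : ∀ {x} → x ∈ map proj₁ (cyclicSteps C) → attached x ≡ true →
             x ∈ map proj₁ (filterᵇ (attached ∘ proj₁) (cyclicSteps C))
    first∈ x∈ ax with ∈-map⁻ proj₁ x∈
    ... | xy , xy∈ , refl = ∈-map⁺ proj₁ (∈-filter⁺ (T? ∘ attached ∘ proj₁) xy∈ (Equivalence.from T-≡ ax))

  walk-from-H-avoids-C : ∀ {u z} → Walk G attached u z → inH u ≡ true → z ∉ onCycle C
  walk-from-H-avoids-C here hu = inH⇒∉C hu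
  walk-from-H-avoids-C (step {w = w} uw aw rest) hu = walk-from-H-avoids-C rest (inH-closed hu uw w∉C)
    where
    w∉C : w ∉ onCycle C
    w∉C w∈C with () ← trans (sym aw) (dec-true (attached? w) (w∈C , _ , Adj-sym uw , hu))

  unattached-on-C : NoConsecutive → ∃ λ z → attached z ≡ false × z ∈ onCycle C
  unattached-on-C no-consecutive with attached? (last C) | attached? (first C)
  ... | no ¬a | _ = last C , dec-false (attached? _) ¬a , end∈ (path C)
  ... | yes _ | no ¬a = first C , dec-false (attached? _) ¬a , start∈ (path C)
  ... | yes a | yes a′ = ⊥-elim (no-consecutive (here refl) (a , a′))

  k≤count-attached : NoConsecutive → k ≤ count attached
  k≤count-attached no-consecutive with unattached-on-C no-consecutive
  ... | z , az , z∈C = ≮⇒≥ λ few-attached → walk-from-H-avoids-C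
      (proj₂ k-conn attached few-attached h z (dec-false (attached? h) (h∉C ∘ proj₁)) az) inH-h z∈C

  inI : Fin n → Bool
  inI v = does (v ≟ᶠ h ⊎-dec v ∈? successors)

  inI-independent : NoConsecutive → NoAdjacentSuccessors → Independent G inI
  inI-independent no-consecutive no-adjacent {u} {v} iu iv =
    ¬-not (clash (dec-true⁻¹ (u ≟ᶠ h ⊎-dec u ∈? successors) iu) (dec-true⁻¹ (v ≟ᶠ h ⊎-dec v ∈? successors) iv))
    where
    h-not-adjacent : ∀ {y} → y ∈ successors → ¬ Adj h y
    h-not-adjacent y∈ hy with ∈-successors⁻ y∈
    ... | x , xy∈ , ax = no-consecutive xy∈ (ax , successor∈C xy∈ , h , Adj-sym hy , inH-h)
    clash : u ≡ h ⊎ u ∈ successors → v ≡ h ⊎ v ∈ successors → ¬ Adj u v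
    clash (inj₁ refl) (inj₁ refl) = Adj-irrefl
    clash (inj₁ refl) (inj₂ v∈) = h-not-adjacent v∈
    clash (inj₂ u∈) (inj₁ refl) uv = h-not-adjacent u∈ (Adj-sym uv)
    clash (inj₂ u∈) (inj₂ v∈) uv with u ≟ᶠ v | ∈-successors⁻ u∈ | ∈-successors⁻ v∈
    ... | yes refl | _ | _ = Adj-irrefl uv
    ... | no u≢v | _ , xu∈ , ax | _ , xv∈ , ax′ = no-adjacent xu∈ xv∈ (ax , ax′ , u≢v , uv)

  k+1≤count-inI : NoConsecutive → suc k ≤ count inI
  k+1≤count-inI no-consecutive = ≤-trans (s≤s (≤-trans (k≤count-attached no-consecutive) count-attached≤))
    (Unique⇒length≤count {p = inI} (Unique-∷ h∉successors successors-unique) in-inI)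
    where
    in-inI : ∀ {v} → v ∈ h ∷ successors → inI v ≡ true
    in-inI {v} (here refl) = dec-true (v ≟ᶠ h ⊎-dec v ∈? successors) (inj₁ refl)
    in-inI {v} (there v∈) = dec-true (v ≟ᶠ h ⊎-dec v ∈? successors) (inj₂ v∈)
    h∉successors : h ∉ successors
    h∉successors h∈ with ∈-successors⁻ h∈
    ... | _ , xh∈ , _ = h∉C (successor∈C xh∈)

  extend : LongerCycle ⊎ ∃ λ I → Independent G I × suc k ≤ count I
  extend with Any.any? (λ xy → attached? (proj₁ xy) ×-dec attached? (proj₂ xy)) (cyclicSteps C)
  ... | yes consecutive with find consecutive
  ...   | _ , xy∈ , ax , ay = inj₁ (longer-via-consecutive xy∈ ax ay)
  extend | no no-consecutive with Any.any? (λ xy₁ → Any.any? (λ xy₂ →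
             attached? (proj₁ xy₁) ×-dec attached? (proj₁ xy₂) ×-dec ¬? (proj₂ xy₁ ≟ᶠ proj₂ xy₂)
             ×-dec adj G (proj₂ xy₁) (proj₂ xy₂) ≟ᵇ true) (cyclicSteps C)) (cyclicSteps C)
  ... | yes adjacent with find adjacent
  ...   | _ , xy₁∈ , adjacent′ with find adjacent′
  ...     | _ , xy₂∈ , a₁ , a₂ , y₁≢y₂ , y₁y₂ = inj₁ (longer-via-adjacent-successors xy₁∈ xy₂∈ a₁ a₂ y₁≢y₂ y₁y₂)
  extend | no no-consecutive | no no-adjacent =
    inj₂ (inI , inI-independent no-consecutive′ no-adjacent′ , k+1≤count-inI no-consecutive′)
    where
    no-consecutive′ : NoConsecutive
    no-consecutive′ xy∈ a = no-consecutive (lose xy∈ a)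
    no-adjacent′ : NoAdjacentSuccessors
    no-adjacent′ xy₁∈ xy₂∈ a = no-adjacent (lose xy₁∈ (lose xy₂∈ a))

k≤degree : ∀ {n k} (G : Graph n) → KConnected k G → ∀ u → k ≤ degree G u
k≤degree {n} {k} G (k<n , connected) u = ≮⇒≥ small-degree-impossible
  where
  trapped : ∀ {z} → z ≢ u → ¬ Walk G (adj G u) u z
  trapped z≢u here = z≢u refl
  trapped _ (step uw w∉ _) with () ← trans (sym uw) w∉
  small-degree-impossible : ¬ degree G u < k
  small-degree-impossible d<k with any? (λ z → ¬? (z ≟ᶠ u) ×-dec adj G u z ≟ᵇ false)
  ... | yes (z , z≢u , uz) = trapped z≢u (connected (adj G u) d<k u z (irrefl G u) uz)
  ... | no ∄far = <-irrefl refl (≤-<-trans n≤1+d (≤-<-trans d<k k<n))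
    where
    near : ∀ v → v ∈ u ∷ support (adj G u)
    near v with v ≟ᶠ u
    ... | yes refl = here refl
    ... | no v≢u = there (∈-support⁺ {p = adj G u} (¬-not λ uv → ∄far (v , v≢u , uv)))
    n≤1+d : n ≤ suc (degree G u)
    n≤1+d = subst₂ _≤_ length-allFin (cong suc (sym (count≡length-support (adj G u))))
      (Unique⇒length≤ (allFin⁺ n) λ {v} _ → near v)

module _ {n : ℕ} (G : Graph n) (k : ℕ) (k-conn : KConnected k G) where

  open Paths G
  open DecMembership (_≟ᶠ_ {n}) using (_∈?_; _∉?_)

  HamiltonianOrIndependent : Set
  HamiltonianOrIndependent = Hamiltonian G ⊎ ∃ λ I → Independent G I × suc k ≤ count I

  grow : ∀ fuel (C : Cycle) → n ≤ cycleLength C + fuel → HamiltonianOrIndependent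
  grow fuel C enough with any? (λ v → v ∉? onCycle C)
  ... | no ∄off = inj₁ (spanning⇒Hamiltonian C (≤-antisym (cycleLength≤n C) n≤length))
    where
    n≤length : n ≤ cycleLength C
    n≤length = subst (_≤ cycleLength C) length-allFin (Unique⇒length≤ (allFin⁺ n)
      λ {v} _ → decidable-stable (v ∈? onCycle C) λ v∉C → ∄off (v , v∉C))
  ... | yes (h , h∉C) with Extension.extend G k k-conn C h h∉C
  ...   | inj₂ independent = inj₂ independent
  ...   | inj₁ (C′ , longer) with fuel
  ...     | zero = ⊥-elim (<⇒≱ longer (≤-trans (cycleLength≤n C′) (subst (n ≤_) (+-identityʳ _) enough)))
  ...     | suc fuel′ = grow fuel′ C′ (≤-trans enough (subst (_≤ cycleLength C′ + fuel′) (sym (+-suc _ fuel′))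
                                                         (+-monoˡ-≤ fuel′ longer)))

  hamiltonian-or-independent : 1 ≤ k → HamiltonianOrIndependent
  hamiltonian-or-independent 1≤k =
    let (_ , edge) = count>0⇒∃ {p = adj G v₀} (≤-trans 1≤k (k≤degree G k-conn v₀))
    in grow n (edge-cycle edge) (m≤n+m n 2)
    where
    v₀ : Fin n
    v₀ = Fin.fromℕ< (≤-<-trans z≤n (proj₁ k-conn))

private
  ordered-square-sum≤double-product⇒≡ : ∀ {x z} → x ≤ z → x * x + z * z ≤ 2 * x * z → x ≡ z
  ordered-square-sum≤double-product⇒≡ {x} x≤z sq≤ with m≤n⇒∃[o]m+o≡n x≤z
  ... | d , refl = d≡0⇒ d (+-cancelˡ-≤ (2 * x * (x + d)) (d * d) 0
                             (subst₂ _≤_ (expand x d) (sym (+-identityʳ _)) sq≤))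
    where
    expand : ∀ x d → x * x + (x + d) * (x + d) ≡ 2 * x * (x + d) + d * d
    expand = solve-∀
    d≡0⇒ : ∀ d → d * d ≤ 0 → x ≡ x + d
    d≡0⇒ zero _ = sym (+-identityʳ x)
    d≡0⇒ (suc _) ()

square-sum≤double-product⇒≡ : ∀ x z → x * x + z * z ≤ 2 * x * z → x ≡ z
square-sum≤double-product⇒≡ x z sq≤ with ≤-total x z
... | inj₁ x≤z = ordered-square-sum≤double-product⇒≡ x≤z sq≤
... | inj₂ z≤x = sym (ordered-square-sum≤double-product⇒≡ z≤x
                        (subst₂ _≤_ (+-comm (x * x) (z * z)) (double-product-comm x z) sq≤))
  where
  double-product-comm : ∀ x z → 2 * x * z ≡ 2 * z * x
  double-product-comm = solve-∀

square-≤⇒≤ : ∀ {a b} → a * a ≤ b * b → a ≤ b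
square-≤⇒≤ a²≤b² = ≮⇒≥ λ b<a → <⇒≱ (*-mono-< b<a b<a) a²≤b²

zagreb-squeeze : ∀ {y x E SI SW D} → 0 < y →
  D * (4 * y) + E * E ≤ (SI + SW) * (4 * y) → SW ≤ D → SI + y ≤ x → x ≤ E →
  x ≡ 2 * y × E ≡ x × D ≤ SW
zagreb-squeeze {y} {x} {E} {SI} {SW} {D} 0<y hyp SW≤D SI+y≤x x≤E = x≡2y , E≡x , D≤SW
  where
  open ≤-Reasoning
  c : ℕ
  c = 4 * y
  E²≤SIc : E * E ≤ SI * c
  E²≤SIc = +-cancelˡ-≤ (D * c) (E * E) (SI * c) (begin
    D * c + E * E        ≤⟨ hyp ⟩
    (SI + SW) * c        ≡⟨ *-distribʳ-+ c SI SW ⟩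
    SI * c + SW * c      ≤⟨ +-monoʳ-≤ (SI * c) (*-monoˡ-≤ c SW≤D) ⟩
    SI * c + D * c       ≡⟨ +-comm (SI * c) (D * c) ⟩
    D * c + SI * c       ∎)
  SIc+yc≤xc : SI * c + y * c ≤ x * c
  SIc+yc≤xc = subst (_≤ x * c) (*-distribʳ-+ c SI y) (*-monoˡ-≤ c SI+y≤x)
  x≡2y : x ≡ 2 * y
  x≡2y = square-sum≤double-product⇒≡ x (2 * y) (begin
    x * x + 2 * y * (2 * y)  ≡⟨ cong (x * x +_) (square-2y y) ⟩
    x * x + y * c            ≤⟨ +-monoˡ-≤ (y * c) (≤-trans (*-mono-≤ x≤E x≤E) E²≤SIc) ⟩
    SI * c + y * c           ≤⟨ SIc+yc≤xc ⟩
    x * c                    ≡⟨ x*4y x y ⟩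
    2 * x * (2 * y)          ∎)
    where
    square-2y : ∀ y → 2 * y * (2 * y) ≡ y * (4 * y)
    square-2y = solve-∀
    x*4y : ∀ x y → x * (4 * y) ≡ 2 * x * (2 * y)
    x*4y = solve-∀
  xc≡x²+yc : x * c ≡ x * x + y * c
  xc≡x²+yc rewrite x≡2y = tight y
    where
    tight : ∀ y → 2 * y * (4 * y) ≡ 2 * y * (2 * y) + y * (4 * y)
    tight = solve-∀
  SIc≤x² : SI * c ≤ x * x
  SIc≤x² = +-cancelʳ-≤ (y * c) (SI * c) (x * x) (subst (SI * c + y * c ≤_) xc≡x²+yc SIc+yc≤xc)
  E≡x : E ≡ x
  E≡x = ≤-antisym (square-≤⇒≤ (≤-trans E²≤SIc SIc≤x²)) x≤E
  D≤SW : D ≤ SW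
  D≤SW = *-cancelʳ-≤ D SW c {{>-nonZero (*-monoʳ-< 4 0<y)}} (+-cancelˡ-≤ (E * E) (D * c) (SW * c) (begin
    E * E + D * c        ≡⟨ +-comm (E * E) (D * c) ⟩
    D * c + E * E        ≤⟨ hyp ⟩
    (SI + SW) * c        ≡⟨ *-distribʳ-+ c SI SW ⟩
    SI * c + SW * c      ≤⟨ +-monoˡ-≤ (SW * c) (≤-trans SIc≤x² (≤-reflexive (cong (λ t → t * t) (sym E≡x)))) ⟩
    E * E + SW * c       ∎))

balanced-sides : ∀ {k δ Δ m} → 1 ≤ k → k ≤ δ → δ ≤ Δ → Δ ≤ k + 1 → m ≤ k + 1 →
                 (δ + m) * Δ ≡ 2 * δ * (k + 1) → m ≡ δ
balanced-sides {k} {δ} {Δ} {m} 1≤k k≤δ δ≤Δ Δ≤k+1 m≤k+1 eq with Δ ≤? k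
... | yes Δ≤k = ⊥-elim (<-irrefl k+m≡ (begin-strict
    k + m             ≤⟨ +-monoʳ-≤ k m≤k+1 ⟩
    k + (k + 1)       <⟨ +-monoˡ-< (k + 1) (n<1+n k) ⟩
    suc k + (k + 1)   ≡⟨ twice k ⟩
    2 * (k + 1)       ∎))
  where
  open ≤-Reasoning
  twice : ∀ k → suc k + (k + 1) ≡ 2 * (k + 1)
  twice = solve-∀
  δ≡k : δ ≡ k
  δ≡k = ≤-antisym (≤-trans δ≤Δ Δ≤k) k≤δ
  Δ≡k : Δ ≡ k
  Δ≡k = ≤-antisym Δ≤k (≤-trans k≤δ δ≤Δ)
  k+m≡ : k + m ≡ 2 * (k + 1)
  k+m≡ = *-cancelʳ-≡ (k + m) (2 * (k + 1)) k {{>-nonZero 1≤k}}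
    (trans (subst₂ (λ d D → (d + m) * D ≡ 2 * d * (k + 1)) δ≡k Δ≡k eq) (reassoc k))
    where
    reassoc : ∀ k → 2 * k * (k + 1) ≡ 2 * (k + 1) * k
    reassoc = solve-∀
... | no Δ≰k = +-cancelˡ-≡ δ m δ (*-cancelʳ-≡ (δ + m) (δ + δ) (k + 1) {{>-nonZero (m≤n+m 1 k)}}
    (trans (subst (λ D → (δ + m) * D ≡ 2 * δ * (k + 1)) Δ≡k+1 eq) (double δ (k + 1))))
  where
  Δ≡k+1 : Δ ≡ k + 1
  Δ≡k+1 = ≤-antisym Δ≤k+1 (subst (_≤ Δ) (+-comm 1 k) (≰⇒> Δ≰k))
  double : ∀ δ K → 2 * δ * K ≡ (δ + δ) * K
  double = solve-∀

sandwiched-square : ∀ {δ d m} → δ ≤ d → d ≤ m → d * d + δ * m ≤ (δ + m) * d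
sandwiched-square {δ} {d} δ≤d d≤m with m≤n⇒∃[o]m+o≡n d≤m
... | b , refl = subst₂ _≤_ (sym (lhs δ d b)) (sym (rhs δ d b))
    (+-monoʳ-≤ (d * d + δ * d) (subst (δ * b ≤_) (*-comm d b) (*-monoˡ-≤ b δ≤d)))
  where
  lhs : ∀ δ d b → d * d + δ * (d + b) ≡ d * d + δ * d + δ * b
  lhs = solve-∀
  rhs : ∀ δ d b → (δ + (d + b)) * d ≡ d * d + δ * d + b * d
  rhs = solve-∀

module _ {A : Set} where

  interleave : List A → List A → List A
  interleave (a ∷ as) (b ∷ bs) = a ∷ b ∷ interleave as bs
  interleave _ _ = []

  ∈-interleave⁻ : ∀ xs ys {z} → z ∈ interleave xs ys → z ∈ xs ⊎ z ∈ ys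
  ∈-interleave⁻ (a ∷ as) (b ∷ bs) (here refl) = inj₁ (here refl)
  ∈-interleave⁻ (a ∷ as) (b ∷ bs) (there (here refl)) = inj₂ (here refl)
  ∈-interleave⁻ (a ∷ as) (b ∷ bs) (there (there z∈)) with ∈-interleave⁻ as bs z∈
  ... | inj₁ z∈as = inj₁ (there z∈as)
  ... | inj₂ z∈bs = inj₂ (there z∈bs)

  Unique-interleave : ∀ {xs ys} → Unique xs → Unique ys → Disjoint xs ys → Unique (interleave xs ys)
  Unique-interleave {a ∷ as} {b ∷ bs} ua@(_ ∷ uas) ub@(_ ∷ ubs) disj =
    Unique-∷ a∉ (Unique-∷ b∉ (Unique-interleave uas ubs λ (z∈as , z∈bs) → disj (there z∈as , there z∈bs)))
    where
    a∉ : a ∉ b ∷ interleave as bs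
    a∉ (here refl) = disj (here refl , here refl)
    a∉ (there a∈) with ∈-interleave⁻ as bs a∈
    ... | inj₁ a∈as = Unique[x∷xs]⇒x∉xs ua a∈as
    ... | inj₂ a∈bs = disj (here refl , there a∈bs)
    b∉ : b ∉ interleave as bs
    b∉ b∈ with ∈-interleave⁻ as bs b∈
    ... | inj₁ b∈as = disj (there b∈as , here refl)
    ... | inj₂ b∈bs = Unique[x∷xs]⇒x∉xs ub b∈bs
  Unique-interleave {[]} _ _ _ = []
  Unique-interleave {_ ∷ _} {[]} _ _ _ = []

  length-interleave : ∀ xs ys → length xs ≡ length ys → length (interleave xs ys) ≡ length xs + length ys
  length-interleave [] [] _ = refl
  length-interleave (a ∷ as) (b ∷ bs) len≡ =
    cong suc (trans (cong suc (length-interleave as bs (suc-injective len≡))) (sym (+-suc (length as) (length bs))))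

module CompleteBipartite {n : ℕ} (G : Graph n) (S : Fin n → Bool)
  (complete : ∀ {u v} → S u ≡ true → S v ≡ false → adj G u v ≡ true) where

  open Paths G

  zigzag : ∀ a as b bs → length as ≡ length bs → S a ≡ true → All (λ z → S z ≡ true) as →
           S b ≡ false → All (λ z → S z ≡ false) bs →
           ∃ λ z → S z ≡ false × Σ (Path a z) λ p → vertices p ≡ interleave (a ∷ as) (b ∷ bs)
  zigzag a [] b [] _ sa _ sb _ = b , sb , a ∷⟨ complete sa sb ⟩ end b , refl
  zigzag a (a′ ∷ as) b (b′ ∷ bs) len≡ sa (sa′ ∷ sas) sb (sb′ ∷ sbs)
    with zigzag a′ as b′ bs (suc-injective len≡) sa′ sas sb′ sbs
  ... | z , sz , p , vertices-p =
    z , sz , a ∷⟨ complete sa sb ⟩ b ∷⟨ Adj-sym (complete sa′ sb) ⟩ p , cong (λ l → a ∷ b ∷ l) vertices-p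

  module _ {a as b bs} (S-list : support S ≡ a ∷ as) (T-list : support (not ∘ S) ≡ b ∷ bs)
           (|S|≡|T| : count S ≡ count (not ∘ S)) where

    in-S : ∀ {v} → v ∈ a ∷ as → S v ≡ true
    in-S v∈ = ∈-support⁻ {p = S} (subst (_ ∈_) (sym S-list) v∈)

    in-T : ∀ {v} → v ∈ b ∷ bs → S v ≡ false
    in-T v∈ = not-injective (∈-support⁻ {p = not ∘ S} (subst (_ ∈_) (sym T-list) v∈))

    sides≡ : length (a ∷ as) ≡ length (b ∷ bs)
    sides≡ = trans (cong length (sym S-list)) (trans (sym (count≡length-support S))
               (trans |S|≡|T| (trans (count≡length-support (not ∘ S)) (cong length T-list))))

    interleaved-unique : Unique (interleave (a ∷ as) (b ∷ bs))
    interleaved-unique = Unique-interleave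
      (subst Unique S-list (filter⁺ (T? ∘ S) (allFin⁺ n)))
      (subst Unique T-list (filter⁺ (T? ∘ not ∘ S) (allFin⁺ n)))
      λ (v∈S , v∈T) → clash (in-S v∈S) (in-T v∈T)
      where
      clash : ∀ {v} → S v ≡ true → S v ≡ false → ⊥
      clash sv sv′ with () ← trans (sym sv) sv′

    interleaved-length : length (interleave (a ∷ as) (b ∷ bs)) ≡ n
    interleaved-length = begin
      length (interleave (a ∷ as) (b ∷ bs))       ≡⟨ length-interleave (a ∷ as) (b ∷ bs) sides≡ ⟩
      length (a ∷ as) + length (b ∷ bs)           ≡⟨ cong₂ (λ xs ys → length xs + length ys) S-list T-list ⟨
      length (support S) + length (support (not ∘ S))
                                                  ≡⟨ cong₂ _+_ (count≡length-support S) (count≡length-support (not ∘ S)) ⟨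
      count S + count (not ∘ S)                   ≡⟨ count-+-not S ⟩
      n                                           ∎
      where open ≡-Reasoning

    interleaved⇒Hamiltonian : Hamiltonian G
    interleaved⇒Hamiltonian with zigzag a as b bs (suc-injective sides≡) (in-S (here refl)) (All.tabulate (in-S ∘ there))
                                                   (in-T (here refl)) (All.tabulate (in-T ∘ there))
    ... | z , sz , p , vertices-p = spanning⇒Hamiltonian
      (cycle p (Adj-sym (complete (in-S (here refl)) sz)) (subst Unique (sym vertices-p) interleaved-unique))
      (trans (cong length vertices-p) interleaved-length)

  balanced⇒Hamiltonian : 0 < count S → count S ≡ count (not ∘ S) → Hamiltonian G
  balanced⇒Hamiltonian 0<|S| |S|≡|T| with support S in S-list | support (not ∘ S) in T-list
  ... | [] | _ = ⊥-elim (<-irrefl refl (subst (0 <_) (trans (count≡length-support S) (cong length S-list)) 0<|S|))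
  ... | _ ∷ _ | [] = ⊥-elim (<-irrefl refl (subst (0 <_)
      (trans (trans |S|≡|T| (count≡length-support (not ∘ S))) (cong length T-list)) 0<|S|))
  ... | _ ∷ _ | _ ∷ _ = interleaved⇒Hamiltonian S-list T-list |S|≡|T|

^2≡* : ∀ a → a ^ 2 ≡ a * a
^2≡* a = cong (a *_) (*-identityʳ a)

𝟙+𝟙≡1⇒ : ∀ {a b} → 𝟙 a + 𝟙 b ≡ 1 → a ≡ true ⊎ b ≡ true
𝟙+𝟙≡1⇒ {true} _ = inj₁ refl
𝟙+𝟙≡1⇒ {false} {true} _ = inj₂ refl

module ExtremalGraph {n : ℕ} (G : Graph n) (k : ℕ) (2≤k : 2 ≤ k) (k-conn : KConnected k G)
  (e δ Δ : ℕ) (e≡ : edgeCount G ≡ e) (min : IsMinDegree G δ) (max : IsMaxDegree G Δ)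
  (hyp : ((n ∸ k ∸ 1) * Δ ^ 2) * (4 * δ * (n ∸ k ∸ 1) * (k + 1)) + (e * (δ + (n ∸ k ∸ 1))) ^ 2
           ≤ M₁ G * (4 * δ * (n ∸ k ∸ 1) * (k + 1)))
  (I : Fin n → Bool) (I-independent : Independent G I) (k<|I| : suc k ≤ count I) where

  open EdgeSums G

  m : ℕ
  m = n ∸ k ∸ 1

  d : Fin n → ℕ
  d = degree G

  W : Fin n → Bool
  W u = not (I u)

  δ≤d : ∀ u → δ ≤ d u
  δ≤d = proj₁ min

  d≤Δ : ∀ u → d u ≤ Δ
  d≤Δ = proj₁ max

  k≤δ : k ≤ δ
  k≤δ = subst (k ≤_) (proj₂ (proj₂ min)) (k≤degree G k-conn (proj₁ (proj₂ min)))

  m+k+1≡n : m + (k + 1) ≡ n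
  m+k+1≡n = trans (cong (_+ (k + 1)) (∸-+-assoc n k 1)) (m∸n+n≡m (subst (_≤ n) (+-comm 1 k) (proj₁ k-conn)))

  |W|≤m : count W ≤ m
  |W|≤m = +-cancelʳ-≤ (k + 1) (count W) m (begin
    count W + (k + 1)    ≤⟨ +-monoʳ-≤ (count W) (subst (_≤ count I) (+-comm 1 k) k<|I|) ⟩
    count W + count I    ≡⟨ +-comm (count W) (count I) ⟩
    count I + count W    ≡⟨ count-+-not I ⟩
    n                    ≡⟨ m+k+1≡n ⟨
    m + (k + 1)          ∎)
    where open ≤-Reasoning

  I-neighbour-in-W : ∀ {u v} → I u ≡ true → adj G u v ≡ true → W v ≡ true
  I-neighbour-in-W {u} {v} iu uv with I v in iv
  ... | true with () ← trans (sym uv) (I-independent iu iv)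
  ... | false = refl

  d≤|W| : ∀ {u} → I u ≡ true → d u ≤ count W
  d≤|W| {u} iu = count-mono {p = adj G u} {q = W} (I-neighbour-in-W iu)

  some-I : ∃ λ u → I u ≡ true
  some-I = count>0⇒∃ {p = I} (≤-trans (s≤s z≤n) k<|I|)

  u₀ : Fin n
  u₀ = proj₁ some-I

  δ≤m : δ ≤ m
  δ≤m = ≤-trans (δ≤d u₀) (≤-trans (d≤|W| (proj₂ some-I)) |W|≤m)

  s SI SW : ℕ
  s = ∑ λ u → 𝟙 (I u) * d u
  SI = ∑ λ u → 𝟙 (I u) * (d u * d u)
  SW = ∑ λ u → 𝟙 (W u) * (d u * d u)

  M₁≡SI+SW : M₁ G ≡ SI + SW
  M₁≡SI+SW = trans (∑-cong split) (∑-+ (λ u → 𝟙 (I u) * (d u * d u)) (λ u → 𝟙 (W u) * (d u * d u)))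
    where
    split : ∀ u → d u ^ 2 ≡ 𝟙 (I u) * (d u * d u) + 𝟙 (W u) * (d u * d u)
    split u with I u
    ... | true = trans (^2≡* (d u)) (sym (trans (+-identityʳ _) (+-identityʳ _)))
    ... | false = trans (^2≡* (d u)) (sym (+-identityʳ _))

  ∑-𝟙-* : ∀ (P : Fin n → Bool) c → ∑ (λ u → 𝟙 (P u) * c) ≡ c * count P
  ∑-𝟙-* P c = trans (∑-cong λ u → *-comm (𝟙 (P u)) c) (∑-*ˡ c (λ u → 𝟙 (P u)))

  SW≤ΔΔ|W| : SW ≤ Δ * Δ * count W
  SW≤ΔΔ|W| = subst (SW ≤_) (∑-𝟙-* W (Δ * Δ)) (∑-mono λ u → *-monoʳ-≤ (𝟙 (W u)) (*-mono-≤ (d≤Δ u) (d≤Δ u)))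

  ΔΔm≡mΔ² : Δ * Δ * m ≡ m * Δ ^ 2
  ΔΔm≡mΔ² = trans (*-comm (Δ * Δ) m) (cong (m *_) (sym (^2≡* Δ)))

  SW≤mΔ² : SW ≤ m * Δ ^ 2
  SW≤mΔ² = ≤-trans SW≤ΔΔ|W| (≤-trans (*-monoʳ-≤ (Δ * Δ) |W|≤m) (≤-reflexive ΔΔm≡mΔ²))

  edge-meets-I-at-most-once : ∀ {u v} → adj G u v ≡ true → 𝟙 (I u) + 𝟙 (I v) ≤ 1
  edge-meets-I-at-most-once {u} {v} uv with I u in iu | I v in iv
  ... | true | true with () ← trans (sym uv) (I-independent iu iv)
  ... | true | false = ≤-refl
  ... | false | true = ≤-refl
  ... | false | false = z≤n

  s≤e : s ≤ e
  s≤e = ≤-trans (≤-reflexive (handshake (λ u → 𝟙 (I u))))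
          (≤-trans (edgeSum-mono edge-meets-I-at-most-once) (≤-reflexive e≡))

  SI+y≤x : SI + δ * m * (k + 1) ≤ (δ + m) * s
  SI+y≤x = begin
    SI + δ * m * (k + 1)          ≤⟨ +-monoʳ-≤ SI (*-monoʳ-≤ (δ * m) (subst (_≤ count I) (+-comm 1 k) k<|I|)) ⟩
    SI + δ * m * count I          ≡⟨ cong (SI +_) (∑-𝟙-* I (δ * m)) ⟨
    SI + ∑ (λ u → 𝟙 (I u) * (δ * m))
                                  ≡⟨ ∑-+ (λ u → 𝟙 (I u) * (d u * d u)) (λ u → 𝟙 (I u) * (δ * m)) ⟨
    ∑ (λ u → 𝟙 (I u) * (d u * d u) + 𝟙 (I u) * (δ * m))
                                  ≤⟨ ∑-mono pointwise ⟩
    ∑ (λ u → (δ + m) * (𝟙 (I u) * d u))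
                                  ≡⟨ ∑-*ˡ (δ + m) (λ u → 𝟙 (I u) * d u) ⟩
    (δ + m) * s                   ∎
    where
    open ≤-Reasoning
    pointwise : ∀ u → 𝟙 (I u) * (d u * d u) + 𝟙 (I u) * (δ * m) ≤ (δ + m) * (𝟙 (I u) * d u)
    pointwise u with I u in iu
    ... | false = z≤n
    ... | true = subst₂ _≤_ (sym (cong₂ _+_ (+-identityʳ (d u * d u)) (+-identityʳ (δ * m))))
                            (cong ((δ + m) *_) (sym (+-identityʳ (d u))))
                            (sandwiched-square (δ≤d u) (≤-trans (d≤|W| iu) |W|≤m))

  y x E : ℕ
  y = δ * m * (k + 1)
  x = (δ + m) * s
  E = e * (δ + m)

  2≤δ : 2 ≤ δ
  2≤δ = ≤-trans 2≤k k≤δ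

  squeeze : x ≡ 2 * y × E ≡ x × m * Δ ^ 2 ≤ SW
  squeeze = zagreb-squeeze 0<y hyp′ SW≤mΔ² SI+y≤x x≤E
    where
    0<y : 0 < y
    0<y = *-mono-≤ (*-mono-≤ (≤-trans (s≤s z≤n) 2≤δ) (≤-trans (s≤s z≤n) (≤-trans 2≤δ δ≤m))) (m≤n+m 1 k)
    c≡4y : ∀ δ m k → 4 * δ * m * (k + 1) ≡ 4 * (δ * m * (k + 1))
    c≡4y = solve-∀
    hyp′ : m * Δ ^ 2 * (4 * y) + E * E ≤ (SI + SW) * (4 * y)
    hyp′ = subst₂ _≤_ (cong₂ _+_ (cong (m * Δ ^ 2 *_) (c≡4y δ m k)) (^2≡* E))
                      (cong₂ _*_ M₁≡SI+SW (c≡4y δ m k)) hyp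
    x≤E : x ≤ E
    x≤E = subst (x ≤_) (*-comm (δ + m) e) (*-monoʳ-≤ (δ + m) s≤e)

  s≡e : s ≡ e
  s≡e = *-cancelˡ-≡ s e (δ + m) {{>-nonZero (≤-trans (s≤s z≤n) (≤-trans 2≤δ (m≤m+n δ m)))}}
          (sym (trans (*-comm (δ + m) e) (proj₁ (proj₂ squeeze))))

  1≤Δ : 1 ≤ Δ
  1≤Δ = ≤-trans (≤-trans (s≤s z≤n) 2≤δ) (≤-trans (δ≤d u₀) (d≤Δ u₀))

  SW≡ΔΔ|W| : SW ≡ Δ * Δ * count W
  SW≡ΔΔ|W| = ≤-antisym SW≤ΔΔ|W| (begin
    Δ * Δ * count W     ≤⟨ *-monoʳ-≤ (Δ * Δ) |W|≤m ⟩
    Δ * Δ * m           ≡⟨ ΔΔm≡mΔ² ⟩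
    m * Δ ^ 2           ≤⟨ proj₂ (proj₂ squeeze) ⟩
    SW                  ∎)
    where open ≤-Reasoning

  |W|≡m : count W ≡ m
  |W|≡m = ≤-antisym |W|≤m (*-cancelˡ-≤ (Δ * Δ) {{>-nonZero (*-mono-≤ 1≤Δ 1≤Δ)}} (begin
    Δ * Δ * m           ≡⟨ ΔΔm≡mΔ² ⟩
    m * Δ ^ 2           ≤⟨ proj₂ (proj₂ squeeze) ⟩
    SW                  ≡⟨ SW≡ΔΔ|W| ⟩
    Δ * Δ * count W     ∎))
    where open ≤-Reasoning

  |I|≡k+1 : count I ≡ k + 1
  |I|≡k+1 = +-cancelʳ-≡ m (count I) (k + 1)
    (trans (cong (count I +_) (sym |W|≡m)) (trans (count-+-not I) (trans (sym m+k+1≡n) (+-comm m (k + 1)))))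

  W-degree≡Δ : ∀ {u} → W u ≡ true → d u ≡ Δ
  W-degree≡Δ {u} wu = ≤-antisym (d≤Δ u) (square-≤⇒≤ (≤-reflexive (sym dd≡ΔΔ)))
    where
    pointwise : 𝟙 (W u) * (d u * d u) ≡ 𝟙 (W u) * (Δ * Δ)
    pointwise = ∑-≡⇒ (λ u → *-monoʳ-≤ (𝟙 (W u)) (*-mono-≤ (d≤Δ u) (d≤Δ u)))
                     (trans SW≡ΔΔ|W| (sym (∑-𝟙-* W (Δ * Δ)))) u
    dd≡ΔΔ : d u * d u ≡ Δ * Δ
    dd≡ΔΔ = trans (sym (+-identityʳ _))
              (trans (subst (λ b → 𝟙 b * (d u * d u) ≡ 𝟙 b * (Δ * Δ)) wu pointwise) (+-identityʳ _))

  edge-meets-I-once : ∀ {u v} → adj G u v ≡ true → (toℕ u <ᵇ toℕ v) ≡ true → 𝟙 (I u) + 𝟙 (I v) ≡ 1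
  edge-meets-I-once = edgeSum-≡⇒ edge-meets-I-at-most-once
    (trans (sym (handshake (λ u → 𝟙 (I u)))) (trans s≡e (sym e≡)))

  edge-meets-I : ∀ {u v} → adj G u v ≡ true → I u ≡ true ⊎ I v ≡ true
  edge-meets-I {u} {v} uv with <ᵇ-trichotomy (toℕ u) (toℕ v)
  ... | inj₁ (u<v , _) = 𝟙+𝟙≡1⇒ (edge-meets-I-once uv u<v)
  ... | inj₂ (inj₁ (_ , v<u)) = Data.Sum.swap (𝟙+𝟙≡1⇒ (edge-meets-I-once (trans (Graph.sym G v u) uv) v<u))
  ... | inj₂ (inj₂ u≡v) with refl ← toℕ-injective u≡v with () ← trans (sym uv) (irrefl G u)

  W-independent : Independent G W
  W-independent {u} {v} wu wv = ¬-not λ uv → [ I-and-W wu , I-and-W wv ]′ (edge-meets-I uv)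
    where
    I-and-W : ∀ {a} → W a ≡ true → I a ≡ true → ⊥
    I-and-W wa ia with () ← trans (sym wa) (cong not ia)

  ∑-W-degree≡e : ∑ (λ u → 𝟙 (W u) * d u) ≡ e
  ∑-W-degree≡e = trans (handshake (λ u → 𝟙 (W u))) (trans (edgeSum-cong edge-meets-W-once) e≡)
    where
    edge-meets-W-once : ∀ {u v} → adj G u v ≡ true → 𝟙 (W u) + 𝟙 (W v) ≡ 1
    edge-meets-W-once {u} {v} uv with I u in iu | I v in iv
    ... | true | true with () ← trans (sym uv) (I-independent iu iv)
    ... | true | false = refl
    ... | false | true = refl
    ... | false | false with edge-meets-I uv
    ...   | inj₁ iu′ with () ← trans (sym iu′) iu
    ...   | inj₂ iv′ with () ← trans (sym iv′) iv

  e≡Δm : e ≡ Δ * m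
  e≡Δm = begin
    e                                ≡⟨ ∑-W-degree≡e ⟨
    ∑ (λ u → 𝟙 (W u) * d u)          ≡⟨ ∑-cong W-term ⟩
    ∑ (λ u → 𝟙 (W u) * Δ)            ≡⟨ ∑-𝟙-* W Δ ⟩
    Δ * count W                      ≡⟨ cong (Δ *_) |W|≡m ⟩
    Δ * m                            ∎
    where
    open ≡-Reasoning
    W-term : ∀ u → 𝟙 (W u) * d u ≡ 𝟙 (W u) * Δ
    W-term u with W u in wu
    ... | true = cong (_+ 0) (W-degree≡Δ wu)
    ... | false = refl

  W-neighbour-in-I : ∀ {w v} → W w ≡ true → adj G w v ≡ true → I v ≡ true
  W-neighbour-in-I {w} {v} ww wv with I v in iv
  ... | true = refl
  ... | false with () ← trans (sym wv) (W-independent ww (cong not iv))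

  some-W : ∃ λ w → W w ≡ true
  some-W = count>0⇒∃ {p = W} (subst (0 <_) (sym |W|≡m) (≤-trans (s≤s z≤n) (≤-trans 2≤δ δ≤m)))

  Δ≤k+1 : Δ ≤ k + 1
  Δ≤k+1 = subst₂ _≤_ (W-degree≡Δ (proj₂ some-W)) |I|≡k+1
    (count-mono {p = adj G (proj₁ some-W)} {q = I} (W-neighbour-in-I (proj₂ some-W)))

  m≤k+1 : m ≤ k + 1
  m≤k+1 = *-cancelˡ-≤ Δ {{>-nonZero 1≤Δ}} (begin
    Δ * m                            ≡⟨ e≡Δm ⟨
    e                                ≡⟨ s≡e ⟨
    s                                ≤⟨ ∑-mono (λ u → *-monoʳ-≤ (𝟙 (I u)) (d≤Δ u)) ⟩
    ∑ (λ u → 𝟙 (I u) * Δ)            ≡⟨ ∑-𝟙-* I Δ ⟩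
    Δ * count I                      ≡⟨ cong (Δ *_) |I|≡k+1 ⟩
    Δ * (k + 1)                      ∎)
    where open ≤-Reasoning

  m≡δ : m ≡ δ
  m≡δ = balanced-sides (≤-trans (s≤s z≤n) 2≤k) k≤δ (≤-trans (δ≤d u₀) (d≤Δ u₀)) Δ≤k+1 m≤k+1
    (*-cancelʳ-≡ ((δ + m) * Δ) (2 * δ * (k + 1)) m {{>-nonZero (≤-trans (s≤s z≤n) (≤-trans 2≤δ δ≤m))}}
      (trans (regroup δ m Δ) (trans (cong ((δ + m) *_) (trans (sym e≡Δm) (sym s≡e)))
        (trans (proj₁ squeeze) (regroup′ δ m k)))))
    where
    regroup : ∀ δ m Δ → (δ + m) * Δ * m ≡ (δ + m) * (Δ * m)
    regroup = solve-∀
    regroup′ : ∀ δ m k → 2 * (δ * m * (k + 1)) ≡ 2 * δ * (k + 1) * m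
    regroup′ = solve-∀

  I-complete-to-W : ∀ {u v} → I u ≡ true → W v ≡ true → adj G u v ≡ true
  I-complete-to-W {u} iu = count-≡⇒ {p = adj G u} {q = W} (I-neighbour-in-W iu)
    (≤-antisym (d≤|W| iu) (subst (_≤ d u) (trans (sym m≡δ) (sym |W|≡m)) (δ≤d u)))

  adj≡xor : ∀ u v → adj G u v ≡ (W u xor W v)
  adj≡xor u v with I u in iu | I v in iv
  ... | true | true = I-independent iu iv
  ... | true | false = I-complete-to-W iu (cong not iv)
  ... | false | true = trans (Graph.sym G u v) (I-complete-to-W iv (cong not iu))
  ... | false | false = W-independent (cong not iu) (cong not iv)

  hamiltonian-or-complete-bipartite : Hamiltonian G ⊎ IsCompleteBipartite G k (suc k)
  hamiltonian-or-complete-bipartite = by-size (m ≟ k)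
    where
    by-size : Dec (m ≡ k) → Hamiltonian G ⊎ IsCompleteBipartite G k (suc k)
    by-size (yes m≡k) = inj₂ (n≡k+[k+1] , W , trans |W|≡m m≡k , adj≡xor)
      where
      n≡k+[k+1] : n ≡ k + suc k
      n≡k+[k+1] = trans (sym (count-+-not I)) (trans (cong₂ _+_ |I|≡k+1 (trans |W|≡m m≡k))
                    (trans (+-comm (k + 1) k) (cong (k +_) (+-comm k 1))))
    by-size (no m≢k) = inj₁ (CompleteBipartite.balanced⇒Hamiltonian G I
      (λ iu iv → I-complete-to-W iu (cong not iv)) (≤-trans (s≤s z≤n) k<|I|) (trans |I|≡k+1 (sym |W|≡k+1)))
      where
      |W|≡k+1 : count W ≡ k + 1
      |W|≡k+1 = trans |W|≡m (≤-antisym m≤k+1 (subst (_≤ m) (+-comm 1 k)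
                  (≤∧≢⇒< (subst (k ≤_) (sym m≡δ) k≤δ) (m≢k ∘ sym))))

theorem1 : (k n : ℕ) → k ≥ 2 → n ≥ 3 → (G : Graph n) → KConnected k G →
    (e δ Δ : ℕ) → edgeCount G ≡ e → IsMinDegree G δ → IsMaxDegree G Δ →
    ((n ∸ k ∸ 1) * Δ ^ 2) * (4 * δ * (n ∸ k ∸ 1) * (k + 1)) + (e * (δ + (n ∸ k ∸ 1))) ^ 2
      ≤ M₁ G * (4 * δ * (n ∸ k ∸ 1) * (k + 1)) →
    Hamiltonian G ⊎ IsCompleteBipartite G k (suc k)
theorem1 k n 2≤k _ G k-conn e δ Δ e≡ min max hyp
  with hamiltonian-or-independent G k k-conn (≤-trans (s≤s z≤n) 2≤k)
... | inj₁ hamiltonian = inj₁ hamiltonian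
... | inj₂ (I , I-independent , k<|I|) =
  ExtremalGraph.hamiltonian-or-complete-bipartite G k 2≤k k-conn e δ Δ e≡ min max hyp I I-independent k<|I|
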